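{- Let $\mathcal Q(6,3)$ be a parabolic quadric of ${\rm PG}(6,3)$ with orthogonal polarity $\perp$. Let $P_1,\dots,P_7$ be internal points forming a self-polar simplex, i.e. $P_i^\perp=\langle P_j: j\ne i\rangle$ for $1\le i\le 7$. Let $\pi=\langle P_1,P_2,P_3\rangle$, $r_1=P_1P_2$, $r_2=P_2P_3$, $r_3=P_3P_1$, $\ell_1=P_4P_5$, $\ell_1'=P_6P_7$, $\ell_2=P_4P_7$, $\ell_2'=P_5P_6$, $\ell_3=P_4P_6$, $\ell_3'=P_5P_7$, and let $\varphi$ be a permutation of $\{1,2,3\}$. For $i=1,2,3$ let $\mathcal R_i$ be one of the two reguli of the hyperbolic quadric $\langle r_i,\ell_{\varphi(i)}\rangle\cap\mathcal Q(6,3)$, $\mathcal R_i'$ one of the two reguli of the hyperbolic quadric $\langle r_i,\ell'_{\varphi(i)}\rangle\cap\mathcal Q(6,3)$, and let $\mathcal R$ be one of the two reguli of the hyperbolic quadric $\pi^\perp\cap\mathcal Q(6,3)$. Then $\mathcal S=\bigcup_{i=1}^3(\mathcal R_i\cup\mathcal R_i')\cup\mathcal R$ is a $1$-system of $\mathcal Q(6,3)$.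
   Context: A point $P\notin\mathcal Q(6,3)$ is internal if $P^\perp\cap\mathcal Q(6,3)$ is an elliptic quadric $\mathcal Q^-(5,3)$ (and external if it is a hyperbolic quadric $\mathcal Q^+(5,3)$). A $1$-system of $\mathcal Q(6,q)$ is a set of $q^3+1$ lines of $\mathcal Q(6,q)$ such that no plane of $\mathcal Q(6,q)$ through one of them has a point in common with the remaining ones. The reguli of a hyperbolic quadric $\mathcal Q^+(3,q)$ are its two families of lines. -}

module Defs where

open import Data.Nat using (ℕ)
open import Data.Fin using (Fin; zero; suc)
open import Data.Vec using (Vec; lookup; zipWith; map; replicate; foldr′; tabulate)
open import Data.List using (List; length; _++_) renaming (lookup to lookupL)
open import Data.List.Membership.Propositional using (_∈_)
open import Data.Product using (Σ; ∃; ∃₂; _×_; _,_)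
open import Data.Sum using (_⊎_)
open import Data.Unit using (⊤)
open import Relation.Nullary using (¬_)
open import Relation.Binary.PropositionalEquality using (_≡_; _≢_)
open import Data.Fin.Permutation using (Permutation′; _⟨$⟩ʳ_)

data F3 : Set where
  𝟘 𝟙 𝟚 : F3

_+₃_ : F3 → F3 → F3
𝟘 +₃ y = y
𝟙 +₃ 𝟘 = 𝟙
𝟙 +₃ 𝟙 = 𝟚
𝟙 +₃ 𝟚 = 𝟘
𝟚 +₃ 𝟘 = 𝟚
𝟚 +₃ 𝟙 = 𝟘
𝟚 +₃ 𝟚 = 𝟙

_*₃_ : F3 → F3 → F3
𝟘 *₃ y = 𝟘
𝟙 *₃ y = y
𝟚 *₃ 𝟘 = 𝟘
𝟚 *₃ 𝟙 = 𝟚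
𝟚 *₃ 𝟚 = 𝟙

infixl 6 _+₃_
infixl 7 _*₃_

_⟺_ : Set → Set → Set
A ⟺ B = (A → B) × (B → A)

-- The vector space V(7,3); projective points of PG(6,3) are the
-- nonzero vectors (up to nonzero scalars).

Vec7 : Set
Vec7 = Vec F3 7

_⊕_ : Vec7 → Vec7 → Vec7
_⊕_ = zipWith _+₃_

_⊙_ : F3 → Vec7 → Vec7
a ⊙ v = map (a *₃_) v

infixl 6 _⊕_
infixl 7 _⊙_

𝟎 : Vec7
𝟎 = replicate 7 𝟘

sum₃ : ∀ {n} → Vec F3 n → F3
sum₃ = foldr′ _+₃_ 𝟘

lincomb : (Fin 7 → F3) → (Fin 7 → Vec7) → Vec7
lincomb c P = foldr′ _⊕_ 𝟎 (tabulate λ j → c j ⊙ P j)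

-- Quadratic forms Q(x) = xᵀ A x with A symmetric (char ≠ 2), the
-- associated (polar) bilinear form B(x,y) = xᵀ A y, defining ⊥.

Mat : Set
Mat = Fin 7 → Fin 7 → F3

bil : Mat → Vec7 → Vec7 → F3
bil A x y = sum₃ (tabulate λ i → sum₃ (tabulate λ j →
              lookup x i *₃ (A i j *₃ lookup y j)))

quad : Mat → Vec7 → F3
quad A x = bil A x x

Symmetric : Mat → Set
Symmetric A = ∀ i j → A i j ≡ A j i

-- nondegenerate polarity: the quadric Q(6,3) is a (nonsingular) parabolic quadric
Nondegenerate : Mat → Set
Nondegenerate A = ∀ x → x ≢ 𝟎 → ∃ λ y → bil A x y ≢ 𝟘

Subsp : Set₁
Subsp = Vec7 → Set

whole : Subsp
whole _ = ⊤

Indep2 : Vec7 → Vec7 → Set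
Indep2 u v = ∀ a b → a ⊙ u ⊕ b ⊙ v ≡ 𝟎 → (a ≡ 𝟘) × (b ≡ 𝟘)

Indep3 : Vec7 → Vec7 → Vec7 → Set
Indep3 u v w = ∀ a b c → a ⊙ u ⊕ b ⊙ v ⊕ c ⊙ w ≡ 𝟎 →
               (a ≡ 𝟘) × (b ≡ 𝟘) × (c ≡ 𝟘)

Line : Set
Line = Vec7 × Vec7

Plane : Set
Plane = Vec7 × Vec7 × Vec7

OnLine : Line → Vec7 → Set
OnLine (u , v) x = ∃₂ λ a b → x ≡ a ⊙ u ⊕ b ⊙ v

OnPlane : Plane → Vec7 → Set
OnPlane (u , v , w) x = ∃₂ λ a b → ∃ λ c → x ≡ a ⊙ u ⊕ b ⊙ v ⊕ c ⊙ w

SameLine : Line → Line → Set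
SameLine l m = ∀ x → OnLine l x ⟺ OnLine m x

DisjointLines : Line → Line → Set
DisjointLines l m = ∀ x → OnLine l x → OnLine m x → x ≡ 𝟎

IsLineIn : Mat → Subsp → Line → Set
IsLineIn A H (u , v) =
  Indep2 u v × (∀ a b → H (a ⊙ u ⊕ b ⊙ v))
             × (∀ a b → quad A (a ⊙ u ⊕ b ⊙ v) ≡ 𝟘)

IsPlaneIn : Mat → Subsp → Plane → Set
IsPlaneIn A H (u , v , w) =
  Indep3 u v w × (∀ a b c → H (a ⊙ u ⊕ b ⊙ v ⊕ c ⊙ w))
               × (∀ a b c → quad A (a ⊙ u ⊕ b ⊙ v ⊕ c ⊙ w) ≡ 𝟘)

DistinctLines : List Line → Set
DistinctLines R = ∀ (i j : Fin (length R)) → i ≢ j →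
                  ¬ SameLine (lookupL R i) (lookupL R j)

-- Reguli: a regulus of the hyperbolic quadric H ∩ Q (H a solid) is one
-- of its two families of lines, i.e. a class of lines of H ∩ Q under
-- the relation "equal or skew".

IsRegulus : Mat → Subsp → List Line → Set
IsRegulus A H R =
  (∃ λ l → l ∈ R)
  × (∀ l → l ∈ R → IsLineIn A H l)
  × DistinctLines R
  × (∀ l → l ∈ R → ∀ m → IsLineIn A H m →
       ((∃ λ k → SameLine (lookupL R k) m) ⟺ (SameLine l m ⊎ DisjointLines l m)))

perp : Mat → Vec7 → Subsp
perp A P x = bil A P x ≡ 𝟘

-- H ∩ Q is an elliptic quadric Q⁻(5,q) of the hyperplane H:
-- nondegenerate on H and containing no plane (Witt index 2).
EllipticIn : Mat → Subsp → Set
EllipticIn A H =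
  (∀ x → H x → x ≢ 𝟎 → ∃ λ y → H y × bil A x y ≢ 𝟘)
  × (¬ ∃ λ σ → IsPlaneIn A H σ)

Internal : Mat → Vec7 → Set
Internal A P = quad A P ≢ 𝟘 × EllipticIn A (perp A P)

SelfPolarSimplex : Mat → (Fin 7 → Vec7) → Set
SelfPolarSimplex A P = ∀ i x →
  perp A (P i) x ⟺ (∃ λ (c : Fin 7 → F3) → (c i ≡ 𝟘) × (x ≡ lincomb c P))

-- 1-systems of Q(6,q), q = 3: q^3+1 = 28 lines of Q such that no plane
-- of Q through one of them meets any of the remaining ones.

OneSystem : Mat → List Line → Set
OneSystem A S =
  (length S ≡ 28)
  × (∀ l → l ∈ S → IsLineIn A whole l)
  × DistinctLines S
  × (∀ (i j : Fin (length S)) → i ≢ j → ∀ σ → IsPlaneIn A whole σ →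
       (∀ x → OnLine (lookupL S i) x → OnPlane σ x) →
       ∀ x → OnPlane σ x → OnLine (lookupL S j) x → x ≡ 𝟎)

-- The configuration of the theorem (indices shifted: P 0 … P 6 = P₁ … P₇)

span4 : Vec7 → Vec7 → Vec7 → Vec7 → Subsp
span4 a b c d x = ∃₂ λ s t → ∃₂ λ u w → x ≡ s ⊙ a ⊕ t ⊙ b ⊕ u ⊙ c ⊕ w ⊙ d

rLine : (Fin 7 → Vec7) → Fin 3 → Line
rLine P zero = P zero , P (suc zero)
rLine P (suc zero) = P (suc zero) , P (suc (suc zero))
rLine P (suc (suc zero)) = P (suc (suc zero)) , P zero

p4 p5 p6 p7 : Fin 7
p4 = suc (suc (suc zero))
p5 = suc (suc (suc (suc zero)))
p6 = suc (suc (suc (suc (suc zero))))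
p7 = suc (suc (suc (suc (suc (suc zero)))))

ℓLine : (Fin 7 → Vec7) → Fin 3 → Line
ℓLine P zero = P p4 , P p5
ℓLine P (suc zero) = P p4 , P p7
ℓLine P (suc (suc zero)) = P p4 , P p6

ℓ'Line : (Fin 7 → Vec7) → Fin 3 → Line
ℓ'Line P zero = P p6 , P p7
ℓ'Line P (suc zero) = P p5 , P p6
ℓ'Line P (suc (suc zero)) = P p5 , P p7

join : Line → Line → Subsp
join (a , b) (c , d) = span4 a b c d

πperp : Mat → (Fin 7 → Vec7) → Subsp
πperp A P x = perp A (P zero) x × perp A (P (suc zero)) x × perp A (P (suc (suc zero))) x

unionS : (Fin 3 → List Line) → (Fin 3 → List Line) → List Line → List Line
unionS R R' R₀ =
  R zero ++ R' zero ++ R (suc zero) ++ R' (suc zero)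
  ++ R (suc (suc zero)) ++ R' (suc (suc zero)) ++ R₀

-- In coordinates with respect to the self-polar simplex the quadratic form
-- is diagonal, Σ d_k y_k².  If the weights d_k were not all equal, some
-- P_i^⊥ would contain a plane of the quadric (a witness plane is listed for
-- every weight pattern), contradicting that P_i is internal.  So the form is
-- c·Σ y_k², and every solid spanned by four simplex points carries the
-- hyperbolic quadric c(y₀² + y₁² + y₂² + y₃²), whose two reguli are listed
-- explicitly; each regulus of the statement is one of these two families.
-- A plane of the quadric through a line l lies in l^⊥, so the 1-system
-- condition follows once every other line m of 𝒮 meets l^⊥ trivially, which
-- is checked by computation for every line of either regulus of every solid,
-- for each of the six permutations φ.
module Submission where

open import Defs
open import Relation.Binary.PropositionalEquality
open import Algebra.Bundles using (CommutativeSemiring)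
open import Algebra.Structures {A = F3} _≡_ using (IsCommutativeSemiring)
open import Algebra.Structures.Biased {A = F3} _≡_ using (IsCommutativeSemiringˡ)
open import Data.Empty using (⊥-elim)
open import Data.Fin using (Fin; zero; suc)
open import Data.Fin.Patterns using (0F; 1F; 2F; 3F; 4F; 5F; 6F)
import Data.Fin.Properties as Finₚ
open import Data.Fin.Permutation using (Permutation′; _⟨$⟩ʳ_; _⟨$⟩ˡ_; inverseˡ)
open import Data.List using (List; []; _∷_; length; _++_; concat; map) renaming (lookup to lookupL)
open import Data.List.Membership.Propositional using (_∈_)
open import Data.List.Membership.Propositional.Properties using (∈-lookup)
open import Data.List.Properties using (length-++; ++-identityʳ; tabulate-lookup)
open import Data.List.Relation.Unary.All as All using (All)
import Data.List.Relation.Unary.All.Properties as Allₚ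
open import Data.List.Relation.Unary.AllPairs as AllPairs using (AllPairs; _∷_)
import Data.List.Relation.Unary.AllPairs.Properties as AllPairsₚ
open import Data.List.Relation.Unary.Any using (index)
open import Data.List.Relation.Unary.Any.Properties using (lookup-index)
open import Data.Maybe using (Maybe; just; nothing)
open import Data.Nat using (ℕ; _+_; _*_)
open import Data.Product using (_×_; _,_; ∃; ∃₂; proj₁; proj₂)
open import Data.Sum using (_⊎_; inj₁; inj₂)
open import Data.Vec using (Vec; []; _∷_; lookup; zipWith; replicate; head; tail; foldr′; tabulate; allFin)
  renaming (map to mapᵛ)
open import Data.Vec.Properties using (lookup-zipWith; lookup-map; lookup∘tabulate; ≡-dec)
import Data.Vec.Relation.Unary.All as Allᵛ
import Data.Vec.Relation.Unary.AllPairs as AllPairsᵛ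
open import Data.Vec.Relation.Unary.Unique.Propositional using (Unique)
open import Relation.Binary.Definitions using (DecidableEquality)
open import Relation.Nullary using (¬_; Dec; yes; no)
open import Relation.Nullary.Decidable using (map′; _×-dec_; _⊎-dec_; _→-dec_; ¬?; toWitness)
open import Tactic.RingSolver using (solve-∀)
open import Tactic.RingSolver.Core.AlmostCommutativeRing using (AlmostCommutativeRing; fromCommutativeSemiring)

+₃-identityʳ : ∀ x → x +₃ 𝟘 ≡ x
+₃-identityʳ 𝟘 = refl
+₃-identityʳ 𝟙 = refl
+₃-identityʳ 𝟚 = refl

+₃-comm : ∀ x y → x +₃ y ≡ y +₃ x
+₃-comm 𝟘 y = sym (+₃-identityʳ y)
+₃-comm 𝟙 𝟘 = refl
+₃-comm 𝟙 𝟙 = refl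
+₃-comm 𝟙 𝟚 = refl
+₃-comm 𝟚 𝟘 = refl
+₃-comm 𝟚 𝟙 = refl
+₃-comm 𝟚 𝟚 = refl

+₃-assoc : ∀ x y z → (x +₃ y) +₃ z ≡ x +₃ (y +₃ z)
+₃-assoc 𝟘 y z = refl
+₃-assoc 𝟙 𝟘 z = refl
+₃-assoc 𝟙 𝟙 𝟘 = refl
+₃-assoc 𝟙 𝟙 𝟙 = refl
+₃-assoc 𝟙 𝟙 𝟚 = refl
+₃-assoc 𝟙 𝟚 𝟘 = refl
+₃-assoc 𝟙 𝟚 𝟙 = refl
+₃-assoc 𝟙 𝟚 𝟚 = refl
+₃-assoc 𝟚 𝟘 z = refl
+₃-assoc 𝟚 𝟙 𝟘 = refl
+₃-assoc 𝟚 𝟙 𝟙 = refl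
+₃-assoc 𝟚 𝟙 𝟚 = refl
+₃-assoc 𝟚 𝟚 𝟘 = refl
+₃-assoc 𝟚 𝟚 𝟙 = refl
+₃-assoc 𝟚 𝟚 𝟚 = refl

*₃-identityʳ : ∀ x → x *₃ 𝟙 ≡ x
*₃-identityʳ 𝟘 = refl
*₃-identityʳ 𝟙 = refl
*₃-identityʳ 𝟚 = refl

*₃-zeroʳ : ∀ x → x *₃ 𝟘 ≡ 𝟘
*₃-zeroʳ 𝟘 = refl
*₃-zeroʳ 𝟙 = refl
*₃-zeroʳ 𝟚 = refl

*₃-comm : ∀ x y → x *₃ y ≡ y *₃ x
*₃-comm 𝟘 y = sym (*₃-zeroʳ y)
*₃-comm 𝟙 y = sym (*₃-identityʳ y)
*₃-comm 𝟚 𝟘 = refl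
*₃-comm 𝟚 𝟙 = refl
*₃-comm 𝟚 𝟚 = refl

*₃-assoc : ∀ x y z → (x *₃ y) *₃ z ≡ x *₃ (y *₃ z)
*₃-assoc 𝟘 y z = refl
*₃-assoc 𝟙 y z = refl
*₃-assoc 𝟚 𝟘 z = refl
*₃-assoc 𝟚 𝟙 z = refl
*₃-assoc 𝟚 𝟚 𝟘 = refl
*₃-assoc 𝟚 𝟚 𝟙 = refl
*₃-assoc 𝟚 𝟚 𝟚 = refl

*₃-distribˡ-+₃ : ∀ x y z → x *₃ (y +₃ z) ≡ x *₃ y +₃ x *₃ z
*₃-distribˡ-+₃ 𝟘 y z = refl
*₃-distribˡ-+₃ 𝟙 y z = refl
*₃-distribˡ-+₃ 𝟚 𝟘 z = refl
*₃-distribˡ-+₃ 𝟚 𝟙 𝟘 = refl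
*₃-distribˡ-+₃ 𝟚 𝟙 𝟙 = refl
*₃-distribˡ-+₃ 𝟚 𝟙 𝟚 = refl
*₃-distribˡ-+₃ 𝟚 𝟚 𝟘 = refl
*₃-distribˡ-+₃ 𝟚 𝟚 𝟙 = refl
*₃-distribˡ-+₃ 𝟚 𝟚 𝟚 = refl

*₃-distribʳ-+₃ : ∀ x y z → (y +₃ z) *₃ x ≡ y *₃ x +₃ z *₃ x
*₃-distribʳ-+₃ x y z = begin
  (y +₃ z) *₃ x       ≡⟨ *₃-comm (y +₃ z) x ⟩
  x *₃ (y +₃ z)       ≡⟨ *₃-distribˡ-+₃ x y z ⟩
  x *₃ y +₃ x *₃ z    ≡⟨ cong₂ _+₃_ (*₃-comm x y) (*₃-comm x z) ⟩
  y *₃ x +₃ z *₃ x    ∎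
  where open ≡-Reasoning

*₃-cancelˡ-𝟘 : ∀ {c x} → c ≢ 𝟘 → c *₃ x ≡ 𝟘 → x ≡ 𝟘
*₃-cancelˡ-𝟘 {𝟘} c≢𝟘 _ = ⊥-elim (c≢𝟘 refl)
*₃-cancelˡ-𝟘 {𝟙} _ cx≡𝟘 = cx≡𝟘
*₃-cancelˡ-𝟘 {𝟚} {𝟘} _ _ = refl

+₃-*₃-isCommutativeSemiring : IsCommutativeSemiring _+₃_ _*₃_ 𝟘 𝟙
+₃-*₃-isCommutativeSemiring = IsCommutativeSemiringˡ.isCommutativeSemiring record
  { +-isCommutativeMonoid = record
      { isMonoid = record
          { isSemigroup = record { isMagma = record { isEquivalence = isEquivalence ; ∙-cong = cong₂ _+₃_ } ; assoc = +₃-assoc }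
          ; identity = (λ _ → refl) , +₃-identityʳ }
      ; comm = +₃-comm }
  ; *-isCommutativeMonoid = record
      { isMonoid = record
          { isSemigroup = record { isMagma = record { isEquivalence = isEquivalence ; ∙-cong = cong₂ _*₃_ } ; assoc = *₃-assoc }
          ; identity = (λ _ → refl) , *₃-identityʳ }
      ; comm = *₃-comm }
  ; distribʳ = *₃-distribʳ-+₃
  ; zeroˡ = λ _ → refl }

+₃-*₃-commutativeSemiring : CommutativeSemiring _ _
+₃-*₃-commutativeSemiring = record { isCommutativeSemiring = +₃-*₃-isCommutativeSemiring }

F3-ring : AlmostCommutativeRing _ _
F3-ring = fromCommutativeSemiring +₃-*₃-commutativeSemiring isZero
  where
  isZero : ∀ x → Maybe (𝟘 ≡ x)
  isZero 𝟘 = just refl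
  isZero _ = nothing

open import Algebra.Properties.Semiring.Sum (CommutativeSemiring.semiring +₃-*₃-commutativeSemiring)
  using (sum; sum-syntax; ∑-distrib-+; ∑-comm; *-distribˡ-sum; sum-cong-≗)

infixl 6 _+ᵛ_
infixl 7 _∙ᵛ_

_+ᵛ_ : ∀ {n} → Vec F3 n → Vec F3 n → Vec F3 n
_+ᵛ_ = zipWith _+₃_

_∙ᵛ_ : ∀ {n} → F3 → Vec F3 n → Vec F3 n
a ∙ᵛ v = mapᵛ (a *₃_) v

0ᵛ : ∀ {n} → Vec F3 n
0ᵛ = replicate _ 𝟘

comb : ∀ {n} → F3 → Vec F3 n → F3 → Vec F3 n → Vec F3 n
comb a u b v = a ∙ᵛ u +ᵛ b ∙ᵛ v

∙ᵛ-identityˡ : ∀ {n} (v : Vec F3 n) → 𝟙 ∙ᵛ v ≡ v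
∙ᵛ-identityˡ [] = refl
∙ᵛ-identityˡ (x ∷ v) = cong (x ∷_) (∙ᵛ-identityˡ v)

∙ᵛ-zeroˡ : ∀ {n} (v : Vec F3 n) → 𝟘 ∙ᵛ v ≡ 0ᵛ
∙ᵛ-zeroˡ [] = refl
∙ᵛ-zeroˡ (x ∷ v) = cong (𝟘 ∷_) (∙ᵛ-zeroˡ v)

∙ᵛ-zeroʳ : ∀ {n} a → a ∙ᵛ 0ᵛ {n} ≡ 0ᵛ
∙ᵛ-zeroʳ {ℕ.zero} a = refl
∙ᵛ-zeroʳ {ℕ.suc n} a = cong₂ _∷_ (*₃-zeroʳ a) (∙ᵛ-zeroʳ a)

+ᵛ-identityˡ : ∀ {n} (v : Vec F3 n) → 0ᵛ +ᵛ v ≡ v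
+ᵛ-identityˡ [] = refl
+ᵛ-identityˡ (x ∷ v) = cong (x ∷_) (+ᵛ-identityˡ v)

+ᵛ-identityʳ : ∀ {n} (v : Vec F3 n) → v +ᵛ 0ᵛ ≡ v
+ᵛ-identityʳ [] = refl
+ᵛ-identityʳ (x ∷ v) = cong₂ _∷_ (+₃-identityʳ x) (+ᵛ-identityʳ v)

+ᵛ-assoc : ∀ {n} (u v w : Vec F3 n) → (u +ᵛ v) +ᵛ w ≡ u +ᵛ (v +ᵛ w)
+ᵛ-assoc [] [] [] = refl
+ᵛ-assoc (x ∷ u) (y ∷ v) (z ∷ w) = cong₂ _∷_ (+₃-assoc x y z) (+ᵛ-assoc u v w)

comb-identityˡ : ∀ {n} (u v : Vec F3 n) → comb 𝟙 u 𝟘 v ≡ u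
comb-identityˡ u v = trans (cong₂ _+ᵛ_ (∙ᵛ-identityˡ u) (∙ᵛ-zeroˡ v)) (+ᵛ-identityʳ u)

comb-identityʳ : ∀ {n} (u v : Vec F3 n) → comb 𝟘 u 𝟙 v ≡ v
comb-identityʳ u v = trans (cong₂ _+ᵛ_ (∙ᵛ-zeroˡ u) (∙ᵛ-identityˡ v)) (+ᵛ-identityˡ v)

comb-zero : ∀ {n} (u v : Vec F3 n) → comb 𝟘 u 𝟘 v ≡ 0ᵛ
comb-zero u v = trans (cong₂ _+ᵛ_ (∙ᵛ-zeroˡ u) (∙ᵛ-zeroˡ v)) (+ᵛ-identityˡ 0ᵛ)

comb-comb : ∀ {n} a b α β γ δ (p q : Vec F3 n) →
  comb a (comb α p β q) b (comb γ p δ q) ≡ comb (a *₃ α +₃ b *₃ γ) p (a *₃ β +₃ b *₃ δ) q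
comb-comb a b α β γ δ [] [] = refl
comb-comb a b α β γ δ (p ∷ ps) (q ∷ qs) = cong₂ _∷_ (scalar a b α β γ δ p q) (comb-comb a b α β γ δ ps qs)
  where
  scalar : ∀ a b α β γ δ p q →
    a *₃ (α *₃ p +₃ β *₃ q) +₃ b *₃ (γ *₃ p +₃ δ *₃ q) ≡ (a *₃ α +₃ b *₃ γ) *₃ p +₃ (a *₃ β +₃ b *₃ δ) *₃ q
  scalar = solve-∀ F3-ring

comb-+ᵛ : ∀ {n} a b a′ b′ (u v : Vec F3 n) → comb a u b v +ᵛ comb a′ u b′ v ≡ comb (a +₃ a′) u (b +₃ b′) v
comb-+ᵛ a b a′ b′ [] [] = refl
comb-+ᵛ a b a′ b′ (u ∷ us) (v ∷ vs) = cong₂ _∷_ (scalar a b a′ b′ u v) (comb-+ᵛ a b a′ b′ us vs)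
  where
  scalar : ∀ a b a′ b′ u v → (a *₃ u +₃ b *₃ v) +₃ (a′ *₃ u +₃ b′ *₃ v) ≡ (a +₃ a′) *₃ u +₃ (b +₃ b′) *₃ v
  scalar = solve-∀ F3-ring

comb₃ : ∀ {n} → F3 → Vec F3 n → F3 → Vec F3 n → F3 → Vec F3 n → Vec F3 n
comb₃ a u b v c w = comb a u b v +ᵛ c ∙ᵛ w

comb₃-+ᵛ : ∀ {n} a b c a′ b′ c′ (u v w : Vec F3 n) →
  comb₃ a u b v c w +ᵛ comb₃ a′ u b′ v c′ w ≡ comb₃ (a +₃ a′) u (b +₃ b′) v (c +₃ c′) w
comb₃-+ᵛ a b c a′ b′ c′ [] [] [] = refl
comb₃-+ᵛ a b c a′ b′ c′ (u ∷ us) (v ∷ vs) (w ∷ ws) =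
  cong₂ _∷_ (scalar a b c a′ b′ c′ u v w) (comb₃-+ᵛ a b c a′ b′ c′ us vs ws)
  where
  scalar : ∀ a b c a′ b′ c′ u v w →
    (a *₃ u +₃ b *₃ v +₃ c *₃ w) +₃ (a′ *₃ u +₃ b′ *₃ v +₃ c′ *₃ w) ≡ (a +₃ a′) *₃ u +₃ (b +₃ b′) *₃ v +₃ (c +₃ c′) *₃ w
  scalar = solve-∀ F3-ring

-- 𝟚 = −𝟙 in GF(3).
_−ᵛ_ : ∀ {n} → Vec F3 n → Vec F3 n → Vec F3 n
y −ᵛ z = comb 𝟙 y 𝟚 z

−ᵛ-zero⇒≡ : ∀ {n} (y z : Vec F3 n) → y −ᵛ z ≡ 0ᵛ → y ≡ z
−ᵛ-zero⇒≡ [] [] e = refl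
−ᵛ-zero⇒≡ (y ∷ ys) (z ∷ zs) e = cong₂ _∷_ (scalar y z (cong head e)) (−ᵛ-zero⇒≡ ys zs (cong tail e))
  where
  scalar : ∀ y z → y +₃ 𝟚 *₃ z ≡ 𝟘 → y ≡ z
  scalar 𝟘 𝟘 _ = refl
  scalar 𝟙 𝟙 _ = refl
  scalar 𝟚 𝟚 _ = refl
  scalar 𝟘 𝟙 ()
  scalar 𝟘 𝟚 ()
  scalar 𝟙 𝟘 ()
  scalar 𝟙 𝟚 ()
  scalar 𝟚 𝟘 ()
  scalar 𝟚 𝟙 ()

−ᵛ-self : ∀ {n} (z : Vec F3 n) → z −ᵛ z ≡ 0ᵛ
−ᵛ-self [] = refl
−ᵛ-self (𝟘 ∷ z) = cong (𝟘 ∷_) (−ᵛ-self z)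
−ᵛ-self (𝟙 ∷ z) = cong (𝟘 ∷_) (−ᵛ-self z)
−ᵛ-self (𝟚 ∷ z) = cong (𝟘 ∷_) (−ᵛ-self z)

module _ (A : Mat) where

  private
    entry : Vec7 → Vec7 → Fin 7 → Fin 7 → F3
    entry x y i j = lookup x i *₃ (A i j *₃ lookup y j)

  bil-+ˡ : ∀ x y z → bil A (x ⊕ y) z ≡ bil A x z +₃ bil A y z
  bil-+ˡ x y z = trans (sum-cong-≗ λ i → trans (sum-cong-≗ (term i)) (∑-distrib-+ (entry x z i) (entry y z i)))
                       (∑-distrib-+ (λ i → sum (entry x z i)) (λ i → sum (entry y z i)))
    where
    term : ∀ i j → entry (x ⊕ y) z i j ≡ entry x z i j +₃ entry y z i j
    term i j = trans (cong (_*₃ (A i j *₃ lookup z j)) (lookup-zipWith _+₃_ i x y))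
                     (*₃-distribʳ-+₃ _ (lookup x i) (lookup y i))

  bil-∙ˡ : ∀ a x z → bil A (a ⊙ x) z ≡ a *₃ bil A x z
  bil-∙ˡ a x z = trans (sum-cong-≗ λ i → trans (sum-cong-≗ (term i)) (sym (*-distribˡ-sum a (entry x z i))))
                       (sym (*-distribˡ-sum a (λ i → sum (entry x z i))))
    where
    term : ∀ i j → entry (a ⊙ x) z i j ≡ a *₃ entry x z i j
    term i j = trans (cong (_*₃ (A i j *₃ lookup z j)) (lookup-map i (a *₃_) x)) (*₃-assoc a _ _)

  bil-0ˡ : ∀ z → bil A 𝟎 z ≡ 𝟘
  bil-0ˡ z = trans (cong (λ t → bil A t z) (sym (∙ᵛ-zeroˡ 𝟎))) (bil-∙ˡ 𝟘 𝟎 z)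

  bil-sym : Symmetric A → ∀ x y → bil A x y ≡ bil A y x
  bil-sym sym-A x y = trans (∑-comm (entry x y)) (sum-cong-≗ λ j → sum-cong-≗ λ i → term i j)
    where
    swap : ∀ x a y → x *₃ (a *₃ y) ≡ y *₃ (a *₃ x)
    swap = solve-∀ F3-ring
    term : ∀ i j → entry x y i j ≡ entry y x j i
    term i j = trans (cong (λ t → lookup x i *₃ (t *₃ lookup y j)) (sym-A i j)) (swap (lookup x i) (A j i) (lookup y j))

_≟₃_ : DecidableEquality F3
𝟘 ≟₃ 𝟘 = yes refl
𝟘 ≟₃ 𝟙 = no λ ()
𝟘 ≟₃ 𝟚 = no λ ()
𝟙 ≟₃ 𝟘 = no λ ()
𝟙 ≟₃ 𝟙 = yes refl
𝟙 ≟₃ 𝟚 = no λ ()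
𝟚 ≟₃ 𝟘 = no λ ()
𝟚 ≟₃ 𝟙 = no λ ()
𝟚 ≟₃ 𝟚 = yes refl

_≟ᵛ_ : ∀ {n} → DecidableEquality (Vec F3 n)
_≟ᵛ_ = ≡-dec _≟₃_

∀₃? : {P : F3 → Set} → (∀ x → Dec (P x)) → Dec (∀ x → P x)
∀₃? {P} P? = map′ every (λ h → h 𝟘 , h 𝟙 , h 𝟚) (P? 𝟘 ×-dec P? 𝟙 ×-dec P? 𝟚)
  where
  every : P 𝟘 × P 𝟙 × P 𝟚 → ∀ x → P x
  every (p , _ , _) 𝟘 = p
  every (_ , p , _) 𝟙 = p
  every (_ , _ , p) 𝟚 = p

∃₃? : {P : F3 → Set} → (∀ x → Dec (P x)) → Dec (∃ P)
∃₃? {P} P? = map′ witness cases (P? 𝟘 ⊎-dec P? 𝟙 ⊎-dec P? 𝟚)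
  where
  witness : P 𝟘 ⊎ P 𝟙 ⊎ P 𝟚 → ∃ P
  witness (inj₁ p) = 𝟘 , p
  witness (inj₂ (inj₁ p)) = 𝟙 , p
  witness (inj₂ (inj₂ p)) = 𝟚 , p
  cases : ∃ P → P 𝟘 ⊎ P 𝟙 ⊎ P 𝟚
  cases (𝟘 , p) = inj₁ p
  cases (𝟙 , p) = inj₂ (inj₁ p)
  cases (𝟚 , p) = inj₂ (inj₂ p)

∀ᵛ? : ∀ {n} {P : Vec F3 n → Set} → (∀ v → Dec (P v)) → Dec (∀ v → P v)
∀ᵛ? {ℕ.zero} P? = map′ (λ { p [] → p }) (λ h → h []) (P? [])
∀ᵛ? {ℕ.suc n} P? = map′ (λ { h (a ∷ v) → h a v }) (λ h a v → h (a ∷ v)) (∀₃? λ a → ∀ᵛ? λ v → P? (a ∷ v))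

SameLine-refl : ∀ l → SameLine l l
SameLine-refl l x = (λ p → p) , (λ p → p)

SameLine-sym : ∀ {l m} → SameLine l m → SameLine m l
SameLine-sym l≈m x = proj₂ (l≈m x) , proj₁ (l≈m x)

SameLine-trans : ∀ {l m n} → SameLine l m → SameLine m n → SameLine l n
SameLine-trans l≈m m≈n x = (λ p → proj₁ (m≈n x) (proj₁ (l≈m x) p)) , (λ p → proj₂ (l≈m x) (proj₂ (m≈n x) p))

DisjointLines-resp : ∀ {l m l′ m′} → SameLine l l′ → SameLine m m′ → DisjointLines l m → DisjointLines l′ m′
DisjointLines-resp l≈l′ m≈m′ l∩m x p q = l∩m x (proj₂ (l≈l′ x) p) (proj₂ (m≈m′ x) q)

OnLine-first : ∀ u v → OnLine (u , v) u
OnLine-first u v = 𝟙 , 𝟘 , sym (comb-identityˡ u v)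

OnLine-second : ∀ u v → OnLine (u , v) v
OnLine-second u v = 𝟘 , 𝟙 , sym (comb-identityʳ u v)

OnLine-⊕ : ∀ {l x y} → OnLine l x → OnLine l y → OnLine l (x ⊕ y)
OnLine-⊕ {u , v} (a , b , refl) (a′ , b′ , refl) = a +₃ a′ , b +₃ b′ , comb-+ᵛ a b a′ b′ u v

OnPlane-⊕ : ∀ {σ x y} → OnPlane σ x → OnPlane σ y → OnPlane σ (x ⊕ y)
OnPlane-⊕ {u , v , w} (a , b , c , refl) (a′ , b′ , c′ , refl) =
  a +₃ a′ , b +₃ b′ , c +₃ c′ , comb₃-+ᵛ a b c a′ b′ c′ u v w

DisjointFromPerp : Mat → Line → Line → Set
DisjointFromPerp A l m = ∀ x → OnLine m x → (∀ y → OnLine l y → bil A x y ≡ 𝟘) → x ≡ 𝟎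

Compatible : Mat → Line → Line → Set
Compatible A l m = DisjointFromPerp A l m × DisjointFromPerp A m l

DisjointFromPerp-resp : ∀ {A l m l′ m′} → SameLine l l′ → SameLine m m′ →
                        DisjointFromPerp A l m → DisjointFromPerp A l′ m′
DisjointFromPerp-resp l≈l′ m≈m′ free x x∈m′ x⊥l′ =
  free x (proj₂ (m≈m′ x) x∈m′) (λ y y∈l → x⊥l′ y (proj₁ (l≈l′ y) y∈l))

AllPairs-lookup : ∀ {X : Set} {R : X → X → Set} → (∀ {x y} → R x y → R y x) →
                  ∀ {xs} → AllPairs R xs → ∀ i j → i ≢ j → R (lookupL xs i) (lookupL xs j)
AllPairs-lookup sym-R (_ ∷ _) zero zero i≢j = ⊥-elim (i≢j refl)
AllPairs-lookup sym-R (x~xs ∷ _) zero (suc j) _ = All.lookup x~xs (∈-lookup j)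
AllPairs-lookup sym-R (x~xs ∷ _) (suc i) zero _ = sym-R (All.lookup x~xs (∈-lookup i))
AllPairs-lookup sym-R (_ ∷ pairs) (suc i) (suc j) i≢j = AllPairs-lookup sym-R pairs i j (λ i≡j → i≢j (cong suc i≡j))

AllPairs-from-lookup : ∀ {X : Set} {R : X → X → Set} {xs} →
                       (∀ i j → i ≢ j → R (lookupL xs i) (lookupL xs j)) → AllPairs R xs
AllPairs-from-lookup {R = R} {xs} pairs = subst (AllPairs R) (tabulate-lookup xs) (AllPairsₚ.tabulate⁺ (pairs _ _))

module Singular (A : Mat) (sym-A : Symmetric A) where

  -- quad (x ⊕ y) = quad x + 2 bil x y + quad y, and 2 is invertible in GF(3).
  singular-sum⇒orthogonal : ∀ {x y} → quad A x ≡ 𝟘 → quad A y ≡ 𝟘 → quad A (x ⊕ y) ≡ 𝟘 → bil A x y ≡ 𝟘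
  singular-sum⇒orthogonal {x} {y} qx qy qxy = twice-zero (bil A x y) (trans (sym expand) qxy)
    where
    twice-zero : ∀ b → (𝟘 +₃ b) +₃ (b +₃ 𝟘) ≡ 𝟘 → b ≡ 𝟘
    twice-zero 𝟘 _ = refl
    twice-zero 𝟙 ()
    twice-zero 𝟚 ()
    expand : quad A (x ⊕ y) ≡ (𝟘 +₃ bil A x y) +₃ (bil A x y +₃ 𝟘)
    expand = begin
      bil A (x ⊕ y) (x ⊕ y)                              ≡⟨ bil-+ˡ A x y (x ⊕ y) ⟩
      bil A x (x ⊕ y) +₃ bil A y (x ⊕ y)                 ≡⟨ cong₂ _+₃_ (bil-sym A sym-A x (x ⊕ y)) (bil-sym A sym-A y (x ⊕ y)) ⟩
      bil A (x ⊕ y) x +₃ bil A (x ⊕ y) y                 ≡⟨ cong₂ _+₃_ (bil-+ˡ A x y x) (bil-+ˡ A x y y) ⟩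
      (quad A x +₃ bil A y x) +₃ (bil A x y +₃ quad A y) ≡⟨ cong₂ (λ s t → (s +₃ t) +₃ (bil A x y +₃ _)) qx (bil-sym A sym-A y x) ⟩
      (𝟘 +₃ bil A x y) +₃ (bil A x y +₃ quad A y)        ≡⟨ cong (λ t → (𝟘 +₃ bil A x y) +₃ (bil A x y +₃ t)) qy ⟩
      (𝟘 +₃ bil A x y) +₃ (bil A x y +₃ 𝟘)               ∎
      where open ≡-Reasoning

  singular-closed⇒orthogonal : (S : Vec7 → Set) → (∀ {x y} → S x → S y → S (x ⊕ y)) → (∀ {x} → S x → quad A x ≡ 𝟘) →
                               ∀ {x y} → S x → S y → bil A x y ≡ 𝟘
  singular-closed⇒orthogonal S closed singular {x} {y} x∈S y∈S =
    singular-sum⇒orthogonal {x} {y} (singular x∈S) (singular y∈S) (singular {x ⊕ y} (closed x∈S y∈S))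

  line-orthogonal : ∀ {H l} → IsLineIn A H l → ∀ {x y} → OnLine l x → OnLine l y → bil A x y ≡ 𝟘
  line-orthogonal {l = l} (_ , _ , singular) =
    singular-closed⇒orthogonal (OnLine l) OnLine-⊕ (λ { (a , b , refl) → singular a b })

  plane-orthogonal : ∀ {H σ} → IsPlaneIn A H σ → ∀ {x y} → OnPlane σ x → OnPlane σ y → bil A x y ≡ 𝟘
  plane-orthogonal {σ = σ} (_ , _ , singular) =
    singular-closed⇒orthogonal (OnPlane σ) OnPlane-⊕ (λ { (a , b , c , refl) → singular a b c })

  -- Every plane of the quadric through l lies in the polar of l.
  planes-avoid : ∀ {l m} → DisjointFromPerp A l m → ∀ σ → IsPlaneIn A whole σ →
                 (∀ x → OnLine l x → OnPlane σ x) → ∀ x → OnPlane σ x → OnLine m x → x ≡ 𝟎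
  planes-avoid free σ σ-plane l⊆σ x x∈σ x∈m = free x x∈m (λ y y∈l → plane-orthogonal {whole} σ-plane {x} {y} x∈σ (l⊆σ y y∈l))

  disjointFromPerp⇒distinct : ∀ {H H′ l m} → IsLineIn A H l → IsLineIn A H′ m → DisjointFromPerp A l m → ¬ SameLine l m
  disjointFromPerp⇒distinct {H} {l = l} {m = u , v} l-line (independent , _) free l≈m = 𝟙≢𝟘 (proj₁ (independent 𝟙 𝟘 u+0≡𝟎))
    where
    𝟙≢𝟘 : 𝟙 ≢ 𝟘
    𝟙≢𝟘 ()
    u≡𝟎 : u ≡ 𝟎
    u≡𝟎 = free u (OnLine-first u v) (λ y y∈l → line-orthogonal {H} l-line {u} {y} (proj₂ (l≈m u) (OnLine-first u v)) y∈l)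
    u+0≡𝟎 : 𝟙 ⊙ u ⊕ 𝟘 ⊙ v ≡ 𝟎
    u+0≡𝟎 = trans (comb-identityˡ u v) u≡𝟎

  oneSystem-of-compatible : ∀ {S} → length S ≡ 28 → All (IsLineIn A whole) S → AllPairs (Compatible A) S → OneSystem A S
  oneSystem-of-compatible {S} size lines compatible = size , (λ l l∈S → All.lookup lines l∈S) , distinct , avoid
    where
    line : ∀ i → IsLineIn A whole (lookupL S i)
    line i = All.lookup lines (∈-lookup i)
    pair : ∀ i j → i ≢ j → Compatible A (lookupL S i) (lookupL S j)
    pair = AllPairs-lookup (λ { (p , q) → q , p }) compatible
    distinct : DistinctLines S
    distinct i j i≢j = disjointFromPerp⇒distinct {whole} {whole} (line i) (line j) (proj₁ (pair i j i≢j))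
    avoid : ∀ i j → i ≢ j → ∀ σ → IsPlaneIn A whole σ → (∀ x → OnLine (lookupL S i) x → OnPlane σ x) →
            ∀ x → OnPlane σ x → OnLine (lookupL S j) x → x ≡ 𝟎
    avoid i j i≢j = planes-avoid (proj₁ (pair i j i≢j))

dot : ∀ {n} → Vec F3 n → Vec F3 n → F3
dot [] [] = 𝟘
dot (y ∷ ys) (z ∷ zs) = y *₃ z +₃ dot ys zs

δ : ∀ {n} → Fin n → Fin n → F3 → F3
δ zero zero x = x
δ zero (suc _) _ = 𝟘
δ (suc _) zero _ = 𝟘
δ (suc i) (suc j) x = δ i j x

δ-diagonal : ∀ {n} (i : Fin n) x → δ i i x ≡ x
δ-diagonal zero x = refl
δ-diagonal (suc i) x = δ-diagonal i x

δ-off : ∀ {n} {i j : Fin n} x → i ≢ j → δ i j x ≡ 𝟘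
δ-off {i = zero} {zero} x i≢j = ⊥-elim (i≢j refl)
δ-off {i = zero} {suc j} x _ = refl
δ-off {i = suc i} {zero} x _ = refl
δ-off {i = suc i} {suc j} x i≢j = δ-off x (λ i≡j → i≢j (cong suc i≡j))

δ-scale : ∀ {n} (i j : Fin n) c → δ i j c ≡ c *₃ δ i j 𝟙
δ-scale zero zero c = sym (*₃-identityʳ c)
δ-scale zero (suc j) c = sym (*₃-zeroʳ c)
δ-scale (suc i) zero c = sym (*₃-zeroʳ c)
δ-scale (suc i) (suc j) c = δ-scale i j c

-- The bilinear form with Gram matrix diag(w) on the simplex coordinates
-- y (supported on the indices X) and z (supported on Y).
diagRow : ∀ {n} → F3 → Fin 7 → Vec (Fin 7) n → Vec F3 n → F3
diagRow d i [] [] = 𝟘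
diagRow d i (j ∷ Y) (z ∷ zs) = δ j i d *₃ z +₃ diagRow d i Y zs

diagForm : ∀ {m n} → (Fin 7 → F3) → Vec (Fin 7) m → Vec F3 m → Vec (Fin 7) n → Vec F3 n → F3
diagForm w [] [] Y z = 𝟘
diagForm w (i ∷ X) (y ∷ ys) Y z = y *₃ diagRow (w i) i Y z +₃ diagForm w X ys Y z

unitForm : ∀ {m n} → Vec (Fin 7) m → Vec F3 m → Vec (Fin 7) n → Vec F3 n → F3
unitForm = diagForm (λ _ → 𝟙)

diagForm-scale : ∀ {m n} c (X : Vec (Fin 7) m) y (Y : Vec (Fin 7) n) z →
                 diagForm (λ _ → c) X y Y z ≡ c *₃ unitForm X y Y z
diagForm-scale c [] [] Y z = sym (*₃-zeroʳ c)
diagForm-scale c (i ∷ X) (y ∷ ys) Y z =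
  trans (cong₂ (λ s t → y *₃ s +₃ t) (row-scale Y z) (diagForm-scale c X ys Y z)) (pull c y (diagRow 𝟙 i Y z) _)
  where
  pull : ∀ c y r f → y *₃ (c *₃ r) +₃ c *₃ f ≡ c *₃ (y *₃ r +₃ f)
  pull = solve-∀ F3-ring
  pull-row : ∀ c e z r → (c *₃ e) *₃ z +₃ c *₃ r ≡ c *₃ (e *₃ z +₃ r)
  pull-row = solve-∀ F3-ring
  row-scale : ∀ {n} (Y : Vec (Fin 7) n) z → diagRow c i Y z ≡ c *₃ diagRow 𝟙 i Y z
  row-scale [] [] = sym (*₃-zeroʳ c)
  row-scale (j ∷ Y) (z ∷ zs) =
    trans (cong₂ (λ s t → s *₃ z +₃ t) (δ-scale j i c) (row-scale Y zs)) (pull-row c (δ j i 𝟙) z (diagRow 𝟙 i Y zs))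

row-absent : ∀ {n} d i (Y : Vec (Fin 7) n) z → Allᵛ.All (i ≢_) Y → diagRow d i Y z ≡ 𝟘
row-absent d i [] [] _ = refl
row-absent d i (j ∷ Y) (z ∷ zs) (i≢j Allᵛ.∷ i∉Y) =
  trans (cong (λ t → t *₃ z +₃ diagRow d i Y zs) (δ-off d (λ j≡i → i≢j (sym j≡i)))) (row-absent d i Y zs i∉Y)

diagForm-cons-absent : ∀ {m n} w (X : Vec (Fin 7) m) y j (Y : Vec (Fin 7) n) z zs → Allᵛ.All (j ≢_) X →
                       diagForm w X y (j ∷ Y) (z ∷ zs) ≡ diagForm w X y Y zs
diagForm-cons-absent w [] [] j Y z zs _ = refl
diagForm-cons-absent w (i ∷ X) (y ∷ ys) j Y z zs (j≢i Allᵛ.∷ j∉X) =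
  cong₂ (λ s t → y *₃ (s *₃ z +₃ diagRow (w i) i Y zs) +₃ t) (δ-off (w i) j≢i) (diagForm-cons-absent w X ys j Y z zs j∉X)

unitForm-unique : ∀ {n} (X : Vec (Fin 7) n) y z → Unique X → unitForm X y X z ≡ dot y z
unitForm-unique [] [] [] _ = refl
unitForm-unique (i ∷ X) (y ∷ ys) (z ∷ zs) (i∉X AllPairsᵛ.∷ X-unique) = begin
  y *₃ (δ i i 𝟙 *₃ z +₃ diagRow 𝟙 i X zs) +₃ unitForm X ys (i ∷ X) (z ∷ zs)
    ≡⟨ cong₂ (λ s t → y *₃ (s *₃ z +₃ t) +₃ unitForm X ys (i ∷ X) (z ∷ zs)) (δ-diagonal i 𝟙) (row-absent 𝟙 i X zs i∉X) ⟩
  y *₃ (z +₃ 𝟘) +₃ unitForm X ys (i ∷ X) (z ∷ zs)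
    ≡⟨ cong₂ (λ s t → y *₃ s +₃ t) (+₃-identityʳ z) (diagForm-cons-absent (λ _ → 𝟙) X ys i X z zs i∉X) ⟩
  y *₃ z +₃ unitForm X ys X zs
    ≡⟨ cong (y *₃ z +₃_) (unitForm-unique X ys zs X-unique) ⟩
  y *₃ z +₃ dot ys zs ∎
  where open ≡-Reasoning

combination : ∀ {n} → (Fin n → F3) → (Fin n → Vec7) → Vec7
combination c Q = foldr′ _⊕_ 𝟎 (tabulate λ k → c k ⊙ Q k)

combination-unit : ∀ {n} (j : Fin n) (Q : Fin n → Vec7) → combination (λ k → δ j k 𝟙) Q ≡ Q j
combination-unit zero Q =
  trans (cong₂ _⊕_ (∙ᵛ-identityˡ (Q zero)) (combination-zero (λ k → Q (suc k)))) (+ᵛ-identityʳ (Q zero))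
  where
  combination-zero : ∀ {n} (Q : Fin n → Vec7) → combination (λ _ → 𝟘) Q ≡ 𝟎
  combination-zero {ℕ.zero} Q = refl
  combination-zero {ℕ.suc n} Q = trans (cong₂ _⊕_ (∙ᵛ-zeroˡ (Q zero)) (combination-zero (λ k → Q (suc k)))) (+ᵛ-identityˡ 𝟎)
combination-unit (suc j) Q =
  trans (cong₂ _⊕_ (∙ᵛ-zeroˡ (Q zero)) (combination-unit j (λ k → Q (suc k)))) (+ᵛ-identityˡ (Q (suc j)))

PlaneData : Set
PlaneData = Fin 7 × Vec F3 7 × Vec F3 7 × Vec F3 7

-- For each weight pattern with first entry 𝟙 and not all entries equal, an
-- index i and three coordinate vectors spanning a plane of the quadric
-- Σ D_k y_k² inside the hyperplane y_i = 0 (found by computer search).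
witnessTable : Vec F3 7 → PlaneData
witnessTable (𝟙 ∷ 𝟙 ∷ 𝟙 ∷ 𝟙 ∷ 𝟙 ∷ 𝟙 ∷ 𝟚 ∷ []) = 0F , (𝟘 ∷ 𝟙 ∷ 𝟘 ∷ 𝟘 ∷ 𝟘 ∷ 𝟘 ∷ 𝟙 ∷ []) , (𝟘 ∷ 𝟘 ∷ 𝟙 ∷ 𝟙 ∷ 𝟙 ∷ 𝟘 ∷ 𝟘 ∷ []) , (𝟘 ∷ 𝟘 ∷ 𝟙 ∷ 𝟚 ∷ 𝟘 ∷ 𝟙 ∷ 𝟘 ∷ [])
witnessTable (𝟙 ∷ 𝟙 ∷ 𝟙 ∷ 𝟙 ∷ 𝟙 ∷ 𝟚 ∷ 𝟙 ∷ []) = 0F , (𝟘 ∷ 𝟙 ∷ 𝟘 ∷ 𝟘 ∷ 𝟘 ∷ 𝟙 ∷ 𝟘 ∷ []) , (𝟘 ∷ 𝟘 ∷ 𝟙 ∷ 𝟙 ∷ 𝟙 ∷ 𝟘 ∷ 𝟘 ∷ []) , (𝟘 ∷ 𝟘 ∷ 𝟙 ∷ 𝟚 ∷ 𝟘 ∷ 𝟘 ∷ 𝟙 ∷ [])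
witnessTable (𝟙 ∷ 𝟙 ∷ 𝟙 ∷ 𝟙 ∷ 𝟙 ∷ 𝟚 ∷ 𝟚 ∷ []) = 5F , (𝟙 ∷ 𝟘 ∷ 𝟘 ∷ 𝟘 ∷ 𝟘 ∷ 𝟘 ∷ 𝟙 ∷ []) , (𝟘 ∷ 𝟙 ∷ 𝟙 ∷ 𝟙 ∷ 𝟘 ∷ 𝟘 ∷ 𝟘 ∷ []) , (𝟘 ∷ 𝟙 ∷ 𝟚 ∷ 𝟘 ∷ 𝟙 ∷ 𝟘 ∷ 𝟘 ∷ [])
witnessTable (𝟙 ∷ 𝟙 ∷ 𝟙 ∷ 𝟙 ∷ 𝟚 ∷ 𝟙 ∷ 𝟙 ∷ []) = 0F , (𝟘 ∷ 𝟙 ∷ 𝟘 ∷ 𝟘 ∷ 𝟙 ∷ 𝟘 ∷ 𝟘 ∷ []) , (𝟘 ∷ 𝟘 ∷ 𝟙 ∷ 𝟙 ∷ 𝟘 ∷ 𝟙 ∷ 𝟘 ∷ []) , (𝟘 ∷ 𝟘 ∷ 𝟙 ∷ 𝟚 ∷ 𝟘 ∷ 𝟘 ∷ 𝟙 ∷ [])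
witnessTable (𝟙 ∷ 𝟙 ∷ 𝟙 ∷ 𝟙 ∷ 𝟚 ∷ 𝟙 ∷ 𝟚 ∷ []) = 4F , (𝟙 ∷ 𝟘 ∷ 𝟘 ∷ 𝟘 ∷ 𝟘 ∷ 𝟘 ∷ 𝟙 ∷ []) , (𝟘 ∷ 𝟙 ∷ 𝟙 ∷ 𝟙 ∷ 𝟘 ∷ 𝟘 ∷ 𝟘 ∷ []) , (𝟘 ∷ 𝟙 ∷ 𝟚 ∷ 𝟘 ∷ 𝟘 ∷ 𝟙 ∷ 𝟘 ∷ [])
witnessTable (𝟙 ∷ 𝟙 ∷ 𝟙 ∷ 𝟙 ∷ 𝟚 ∷ 𝟚 ∷ 𝟙 ∷ []) = 4F , (𝟙 ∷ 𝟘 ∷ 𝟘 ∷ 𝟘 ∷ 𝟘 ∷ 𝟙 ∷ 𝟘 ∷ []) , (𝟘 ∷ 𝟙 ∷ 𝟙 ∷ 𝟙 ∷ 𝟘 ∷ 𝟘 ∷ 𝟘 ∷ []) , (𝟘 ∷ 𝟙 ∷ 𝟚 ∷ 𝟘 ∷ 𝟘 ∷ 𝟘 ∷ 𝟙 ∷ [])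
witnessTable (𝟙 ∷ 𝟙 ∷ 𝟙 ∷ 𝟙 ∷ 𝟚 ∷ 𝟚 ∷ 𝟚 ∷ []) = 0F , (𝟘 ∷ 𝟙 ∷ 𝟘 ∷ 𝟘 ∷ 𝟙 ∷ 𝟘 ∷ 𝟘 ∷ []) , (𝟘 ∷ 𝟘 ∷ 𝟙 ∷ 𝟘 ∷ 𝟘 ∷ 𝟙 ∷ 𝟘 ∷ []) , (𝟘 ∷ 𝟘 ∷ 𝟘 ∷ 𝟙 ∷ 𝟘 ∷ 𝟘 ∷ 𝟙 ∷ [])
witnessTable (𝟙 ∷ 𝟙 ∷ 𝟙 ∷ 𝟚 ∷ 𝟙 ∷ 𝟙 ∷ 𝟙 ∷ []) = 0F , (𝟘 ∷ 𝟙 ∷ 𝟘 ∷ 𝟙 ∷ 𝟘 ∷ 𝟘 ∷ 𝟘 ∷ []) , (𝟘 ∷ 𝟘 ∷ 𝟙 ∷ 𝟘 ∷ 𝟙 ∷ 𝟙 ∷ 𝟘 ∷ []) , (𝟘 ∷ 𝟘 ∷ 𝟙 ∷ 𝟘 ∷ 𝟚 ∷ 𝟘 ∷ 𝟙 ∷ [])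
witnessTable (𝟙 ∷ 𝟙 ∷ 𝟙 ∷ 𝟚 ∷ 𝟙 ∷ 𝟙 ∷ 𝟚 ∷ []) = 3F , (𝟙 ∷ 𝟘 ∷ 𝟘 ∷ 𝟘 ∷ 𝟘 ∷ 𝟘 ∷ 𝟙 ∷ []) , (𝟘 ∷ 𝟙 ∷ 𝟙 ∷ 𝟘 ∷ 𝟙 ∷ 𝟘 ∷ 𝟘 ∷ []) , (𝟘 ∷ 𝟙 ∷ 𝟚 ∷ 𝟘 ∷ 𝟘 ∷ 𝟙 ∷ 𝟘 ∷ [])
witnessTable (𝟙 ∷ 𝟙 ∷ 𝟙 ∷ 𝟚 ∷ 𝟙 ∷ 𝟚 ∷ 𝟙 ∷ []) = 3F , (𝟙 ∷ 𝟘 ∷ 𝟘 ∷ 𝟘 ∷ 𝟘 ∷ 𝟙 ∷ 𝟘 ∷ []) , (𝟘 ∷ 𝟙 ∷ 𝟙 ∷ 𝟘 ∷ 𝟙 ∷ 𝟘 ∷ 𝟘 ∷ []) , (𝟘 ∷ 𝟙 ∷ 𝟚 ∷ 𝟘 ∷ 𝟘 ∷ 𝟘 ∷ 𝟙 ∷ [])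
witnessTable (𝟙 ∷ 𝟙 ∷ 𝟙 ∷ 𝟚 ∷ 𝟙 ∷ 𝟚 ∷ 𝟚 ∷ []) = 0F , (𝟘 ∷ 𝟙 ∷ 𝟘 ∷ 𝟙 ∷ 𝟘 ∷ 𝟘 ∷ 𝟘 ∷ []) , (𝟘 ∷ 𝟘 ∷ 𝟙 ∷ 𝟘 ∷ 𝟘 ∷ 𝟙 ∷ 𝟘 ∷ []) , (𝟘 ∷ 𝟘 ∷ 𝟘 ∷ 𝟘 ∷ 𝟙 ∷ 𝟘 ∷ 𝟙 ∷ [])
witnessTable (𝟙 ∷ 𝟙 ∷ 𝟙 ∷ 𝟚 ∷ 𝟚 ∷ 𝟙 ∷ 𝟙 ∷ []) = 3F , (𝟙 ∷ 𝟘 ∷ 𝟘 ∷ 𝟘 ∷ 𝟙 ∷ 𝟘 ∷ 𝟘 ∷ []) , (𝟘 ∷ 𝟙 ∷ 𝟙 ∷ 𝟘 ∷ 𝟘 ∷ 𝟙 ∷ 𝟘 ∷ []) , (𝟘 ∷ 𝟙 ∷ 𝟚 ∷ 𝟘 ∷ 𝟘 ∷ 𝟘 ∷ 𝟙 ∷ [])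
witnessTable (𝟙 ∷ 𝟙 ∷ 𝟙 ∷ 𝟚 ∷ 𝟚 ∷ 𝟙 ∷ 𝟚 ∷ []) = 0F , (𝟘 ∷ 𝟙 ∷ 𝟘 ∷ 𝟙 ∷ 𝟘 ∷ 𝟘 ∷ 𝟘 ∷ []) , (𝟘 ∷ 𝟘 ∷ 𝟙 ∷ 𝟘 ∷ 𝟙 ∷ 𝟘 ∷ 𝟘 ∷ []) , (𝟘 ∷ 𝟘 ∷ 𝟘 ∷ 𝟘 ∷ 𝟘 ∷ 𝟙 ∷ 𝟙 ∷ [])
witnessTable (𝟙 ∷ 𝟙 ∷ 𝟙 ∷ 𝟚 ∷ 𝟚 ∷ 𝟚 ∷ 𝟙 ∷ []) = 0F , (𝟘 ∷ 𝟙 ∷ 𝟘 ∷ 𝟙 ∷ 𝟘 ∷ 𝟘 ∷ 𝟘 ∷ []) , (𝟘 ∷ 𝟘 ∷ 𝟙 ∷ 𝟘 ∷ 𝟙 ∷ 𝟘 ∷ 𝟘 ∷ []) , (𝟘 ∷ 𝟘 ∷ 𝟘 ∷ 𝟘 ∷ 𝟘 ∷ 𝟙 ∷ 𝟙 ∷ [])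
witnessTable (𝟙 ∷ 𝟙 ∷ 𝟙 ∷ 𝟚 ∷ 𝟚 ∷ 𝟚 ∷ 𝟚 ∷ []) = 3F , (𝟙 ∷ 𝟘 ∷ 𝟘 ∷ 𝟘 ∷ 𝟙 ∷ 𝟘 ∷ 𝟘 ∷ []) , (𝟘 ∷ 𝟙 ∷ 𝟘 ∷ 𝟘 ∷ 𝟘 ∷ 𝟙 ∷ 𝟘 ∷ []) , (𝟘 ∷ 𝟘 ∷ 𝟙 ∷ 𝟘 ∷ 𝟘 ∷ 𝟘 ∷ 𝟙 ∷ [])
witnessTable (𝟙 ∷ 𝟙 ∷ 𝟚 ∷ 𝟙 ∷ 𝟙 ∷ 𝟙 ∷ 𝟙 ∷ []) = 0F , (𝟘 ∷ 𝟙 ∷ 𝟙 ∷ 𝟘 ∷ 𝟘 ∷ 𝟘 ∷ 𝟘 ∷ []) , (𝟘 ∷ 𝟘 ∷ 𝟘 ∷ 𝟙 ∷ 𝟙 ∷ 𝟙 ∷ 𝟘 ∷ []) , (𝟘 ∷ 𝟘 ∷ 𝟘 ∷ 𝟙 ∷ 𝟚 ∷ 𝟘 ∷ 𝟙 ∷ [])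
witnessTable (𝟙 ∷ 𝟙 ∷ 𝟚 ∷ 𝟙 ∷ 𝟙 ∷ 𝟙 ∷ 𝟚 ∷ []) = 2F , (𝟙 ∷ 𝟘 ∷ 𝟘 ∷ 𝟘 ∷ 𝟘 ∷ 𝟘 ∷ 𝟙 ∷ []) , (𝟘 ∷ 𝟙 ∷ 𝟘 ∷ 𝟙 ∷ 𝟙 ∷ 𝟘 ∷ 𝟘 ∷ []) , (𝟘 ∷ 𝟙 ∷ 𝟘 ∷ 𝟚 ∷ 𝟘 ∷ 𝟙 ∷ 𝟘 ∷ [])
witnessTable (𝟙 ∷ 𝟙 ∷ 𝟚 ∷ 𝟙 ∷ 𝟙 ∷ 𝟚 ∷ 𝟙 ∷ []) = 2F , (𝟙 ∷ 𝟘 ∷ 𝟘 ∷ 𝟘 ∷ 𝟘 ∷ 𝟙 ∷ 𝟘 ∷ []) , (𝟘 ∷ 𝟙 ∷ 𝟘 ∷ 𝟙 ∷ 𝟙 ∷ 𝟘 ∷ 𝟘 ∷ []) , (𝟘 ∷ 𝟙 ∷ 𝟘 ∷ 𝟚 ∷ 𝟘 ∷ 𝟘 ∷ 𝟙 ∷ [])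
witnessTable (𝟙 ∷ 𝟙 ∷ 𝟚 ∷ 𝟙 ∷ 𝟙 ∷ 𝟚 ∷ 𝟚 ∷ []) = 0F , (𝟘 ∷ 𝟙 ∷ 𝟙 ∷ 𝟘 ∷ 𝟘 ∷ 𝟘 ∷ 𝟘 ∷ []) , (𝟘 ∷ 𝟘 ∷ 𝟘 ∷ 𝟙 ∷ 𝟘 ∷ 𝟙 ∷ 𝟘 ∷ []) , (𝟘 ∷ 𝟘 ∷ 𝟘 ∷ 𝟘 ∷ 𝟙 ∷ 𝟘 ∷ 𝟙 ∷ [])
witnessTable (𝟙 ∷ 𝟙 ∷ 𝟚 ∷ 𝟙 ∷ 𝟚 ∷ 𝟙 ∷ 𝟙 ∷ []) = 2F , (𝟙 ∷ 𝟘 ∷ 𝟘 ∷ 𝟘 ∷ 𝟙 ∷ 𝟘 ∷ 𝟘 ∷ []) , (𝟘 ∷ 𝟙 ∷ 𝟘 ∷ 𝟙 ∷ 𝟘 ∷ 𝟙 ∷ 𝟘 ∷ []) , (𝟘 ∷ 𝟙 ∷ 𝟘 ∷ 𝟚 ∷ 𝟘 ∷ 𝟘 ∷ 𝟙 ∷ [])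
witnessTable (𝟙 ∷ 𝟙 ∷ 𝟚 ∷ 𝟙 ∷ 𝟚 ∷ 𝟙 ∷ 𝟚 ∷ []) = 0F , (𝟘 ∷ 𝟙 ∷ 𝟙 ∷ 𝟘 ∷ 𝟘 ∷ 𝟘 ∷ 𝟘 ∷ []) , (𝟘 ∷ 𝟘 ∷ 𝟘 ∷ 𝟙 ∷ 𝟙 ∷ 𝟘 ∷ 𝟘 ∷ []) , (𝟘 ∷ 𝟘 ∷ 𝟘 ∷ 𝟘 ∷ 𝟘 ∷ 𝟙 ∷ 𝟙 ∷ [])
witnessTable (𝟙 ∷ 𝟙 ∷ 𝟚 ∷ 𝟙 ∷ 𝟚 ∷ 𝟚 ∷ 𝟙 ∷ []) = 0F , (𝟘 ∷ 𝟙 ∷ 𝟙 ∷ 𝟘 ∷ 𝟘 ∷ 𝟘 ∷ 𝟘 ∷ []) , (𝟘 ∷ 𝟘 ∷ 𝟘 ∷ 𝟙 ∷ 𝟙 ∷ 𝟘 ∷ 𝟘 ∷ []) , (𝟘 ∷ 𝟘 ∷ 𝟘 ∷ 𝟘 ∷ 𝟘 ∷ 𝟙 ∷ 𝟙 ∷ [])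
witnessTable (𝟙 ∷ 𝟙 ∷ 𝟚 ∷ 𝟙 ∷ 𝟚 ∷ 𝟚 ∷ 𝟚 ∷ []) = 2F , (𝟙 ∷ 𝟘 ∷ 𝟘 ∷ 𝟘 ∷ 𝟙 ∷ 𝟘 ∷ 𝟘 ∷ []) , (𝟘 ∷ 𝟙 ∷ 𝟘 ∷ 𝟘 ∷ 𝟘 ∷ 𝟙 ∷ 𝟘 ∷ []) , (𝟘 ∷ 𝟘 ∷ 𝟘 ∷ 𝟙 ∷ 𝟘 ∷ 𝟘 ∷ 𝟙 ∷ [])
witnessTable (𝟙 ∷ 𝟙 ∷ 𝟚 ∷ 𝟚 ∷ 𝟙 ∷ 𝟙 ∷ 𝟙 ∷ []) = 2F , (𝟙 ∷ 𝟘 ∷ 𝟘 ∷ 𝟙 ∷ 𝟘 ∷ 𝟘 ∷ 𝟘 ∷ []) , (𝟘 ∷ 𝟙 ∷ 𝟘 ∷ 𝟘 ∷ 𝟙 ∷ 𝟙 ∷ 𝟘 ∷ []) , (𝟘 ∷ 𝟙 ∷ 𝟘 ∷ 𝟘 ∷ 𝟚 ∷ 𝟘 ∷ 𝟙 ∷ [])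
witnessTable (𝟙 ∷ 𝟙 ∷ 𝟚 ∷ 𝟚 ∷ 𝟙 ∷ 𝟙 ∷ 𝟚 ∷ []) = 0F , (𝟘 ∷ 𝟙 ∷ 𝟙 ∷ 𝟘 ∷ 𝟘 ∷ 𝟘 ∷ 𝟘 ∷ []) , (𝟘 ∷ 𝟘 ∷ 𝟘 ∷ 𝟙 ∷ 𝟙 ∷ 𝟘 ∷ 𝟘 ∷ []) , (𝟘 ∷ 𝟘 ∷ 𝟘 ∷ 𝟘 ∷ 𝟘 ∷ 𝟙 ∷ 𝟙 ∷ [])
witnessTable (𝟙 ∷ 𝟙 ∷ 𝟚 ∷ 𝟚 ∷ 𝟙 ∷ 𝟚 ∷ 𝟙 ∷ []) = 0F , (𝟘 ∷ 𝟙 ∷ 𝟙 ∷ 𝟘 ∷ 𝟘 ∷ 𝟘 ∷ 𝟘 ∷ []) , (𝟘 ∷ 𝟘 ∷ 𝟘 ∷ 𝟙 ∷ 𝟙 ∷ 𝟘 ∷ 𝟘 ∷ []) , (𝟘 ∷ 𝟘 ∷ 𝟘 ∷ 𝟘 ∷ 𝟘 ∷ 𝟙 ∷ 𝟙 ∷ [])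
witnessTable (𝟙 ∷ 𝟙 ∷ 𝟚 ∷ 𝟚 ∷ 𝟙 ∷ 𝟚 ∷ 𝟚 ∷ []) = 2F , (𝟙 ∷ 𝟘 ∷ 𝟘 ∷ 𝟙 ∷ 𝟘 ∷ 𝟘 ∷ 𝟘 ∷ []) , (𝟘 ∷ 𝟙 ∷ 𝟘 ∷ 𝟘 ∷ 𝟘 ∷ 𝟙 ∷ 𝟘 ∷ []) , (𝟘 ∷ 𝟘 ∷ 𝟘 ∷ 𝟘 ∷ 𝟙 ∷ 𝟘 ∷ 𝟙 ∷ [])
witnessTable (𝟙 ∷ 𝟙 ∷ 𝟚 ∷ 𝟚 ∷ 𝟚 ∷ 𝟙 ∷ 𝟙 ∷ []) = 0F , (𝟘 ∷ 𝟙 ∷ 𝟙 ∷ 𝟘 ∷ 𝟘 ∷ 𝟘 ∷ 𝟘 ∷ []) , (𝟘 ∷ 𝟘 ∷ 𝟘 ∷ 𝟙 ∷ 𝟘 ∷ 𝟙 ∷ 𝟘 ∷ []) , (𝟘 ∷ 𝟘 ∷ 𝟘 ∷ 𝟘 ∷ 𝟙 ∷ 𝟘 ∷ 𝟙 ∷ [])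
witnessTable (𝟙 ∷ 𝟙 ∷ 𝟚 ∷ 𝟚 ∷ 𝟚 ∷ 𝟙 ∷ 𝟚 ∷ []) = 2F , (𝟙 ∷ 𝟘 ∷ 𝟘 ∷ 𝟙 ∷ 𝟘 ∷ 𝟘 ∷ 𝟘 ∷ []) , (𝟘 ∷ 𝟙 ∷ 𝟘 ∷ 𝟘 ∷ 𝟙 ∷ 𝟘 ∷ 𝟘 ∷ []) , (𝟘 ∷ 𝟘 ∷ 𝟘 ∷ 𝟘 ∷ 𝟘 ∷ 𝟙 ∷ 𝟙 ∷ [])
witnessTable (𝟙 ∷ 𝟙 ∷ 𝟚 ∷ 𝟚 ∷ 𝟚 ∷ 𝟚 ∷ 𝟙 ∷ []) = 2F , (𝟙 ∷ 𝟘 ∷ 𝟘 ∷ 𝟙 ∷ 𝟘 ∷ 𝟘 ∷ 𝟘 ∷ []) , (𝟘 ∷ 𝟙 ∷ 𝟘 ∷ 𝟘 ∷ 𝟙 ∷ 𝟘 ∷ 𝟘 ∷ []) , (𝟘 ∷ 𝟘 ∷ 𝟘 ∷ 𝟘 ∷ 𝟘 ∷ 𝟙 ∷ 𝟙 ∷ [])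
witnessTable (𝟙 ∷ 𝟙 ∷ 𝟚 ∷ 𝟚 ∷ 𝟚 ∷ 𝟚 ∷ 𝟚 ∷ []) = 0F , (𝟘 ∷ 𝟙 ∷ 𝟙 ∷ 𝟘 ∷ 𝟘 ∷ 𝟘 ∷ 𝟘 ∷ []) , (𝟘 ∷ 𝟘 ∷ 𝟘 ∷ 𝟙 ∷ 𝟙 ∷ 𝟙 ∷ 𝟘 ∷ []) , (𝟘 ∷ 𝟘 ∷ 𝟘 ∷ 𝟙 ∷ 𝟚 ∷ 𝟘 ∷ 𝟙 ∷ [])
witnessTable (𝟙 ∷ 𝟚 ∷ 𝟙 ∷ 𝟙 ∷ 𝟙 ∷ 𝟙 ∷ 𝟙 ∷ []) = 0F , (𝟘 ∷ 𝟙 ∷ 𝟙 ∷ 𝟘 ∷ 𝟘 ∷ 𝟘 ∷ 𝟘 ∷ []) , (𝟘 ∷ 𝟘 ∷ 𝟘 ∷ 𝟙 ∷ 𝟙 ∷ 𝟙 ∷ 𝟘 ∷ []) , (𝟘 ∷ 𝟘 ∷ 𝟘 ∷ 𝟙 ∷ 𝟚 ∷ 𝟘 ∷ 𝟙 ∷ [])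
witnessTable (𝟙 ∷ 𝟚 ∷ 𝟙 ∷ 𝟙 ∷ 𝟙 ∷ 𝟙 ∷ 𝟚 ∷ []) = 1F , (𝟙 ∷ 𝟘 ∷ 𝟘 ∷ 𝟘 ∷ 𝟘 ∷ 𝟘 ∷ 𝟙 ∷ []) , (𝟘 ∷ 𝟘 ∷ 𝟙 ∷ 𝟙 ∷ 𝟙 ∷ 𝟘 ∷ 𝟘 ∷ []) , (𝟘 ∷ 𝟘 ∷ 𝟙 ∷ 𝟚 ∷ 𝟘 ∷ 𝟙 ∷ 𝟘 ∷ [])
witnessTable (𝟙 ∷ 𝟚 ∷ 𝟙 ∷ 𝟙 ∷ 𝟙 ∷ 𝟚 ∷ 𝟙 ∷ []) = 1F , (𝟙 ∷ 𝟘 ∷ 𝟘 ∷ 𝟘 ∷ 𝟘 ∷ 𝟙 ∷ 𝟘 ∷ []) , (𝟘 ∷ 𝟘 ∷ 𝟙 ∷ 𝟙 ∷ 𝟙 ∷ 𝟘 ∷ 𝟘 ∷ []) , (𝟘 ∷ 𝟘 ∷ 𝟙 ∷ 𝟚 ∷ 𝟘 ∷ 𝟘 ∷ 𝟙 ∷ [])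
witnessTable (𝟙 ∷ 𝟚 ∷ 𝟙 ∷ 𝟙 ∷ 𝟙 ∷ 𝟚 ∷ 𝟚 ∷ []) = 0F , (𝟘 ∷ 𝟙 ∷ 𝟙 ∷ 𝟘 ∷ 𝟘 ∷ 𝟘 ∷ 𝟘 ∷ []) , (𝟘 ∷ 𝟘 ∷ 𝟘 ∷ 𝟙 ∷ 𝟘 ∷ 𝟙 ∷ 𝟘 ∷ []) , (𝟘 ∷ 𝟘 ∷ 𝟘 ∷ 𝟘 ∷ 𝟙 ∷ 𝟘 ∷ 𝟙 ∷ [])
witnessTable (𝟙 ∷ 𝟚 ∷ 𝟙 ∷ 𝟙 ∷ 𝟚 ∷ 𝟙 ∷ 𝟙 ∷ []) = 1F , (𝟙 ∷ 𝟘 ∷ 𝟘 ∷ 𝟘 ∷ 𝟙 ∷ 𝟘 ∷ 𝟘 ∷ []) , (𝟘 ∷ 𝟘 ∷ 𝟙 ∷ 𝟙 ∷ 𝟘 ∷ 𝟙 ∷ 𝟘 ∷ []) , (𝟘 ∷ 𝟘 ∷ 𝟙 ∷ 𝟚 ∷ 𝟘 ∷ 𝟘 ∷ 𝟙 ∷ [])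
witnessTable (𝟙 ∷ 𝟚 ∷ 𝟙 ∷ 𝟙 ∷ 𝟚 ∷ 𝟙 ∷ 𝟚 ∷ []) = 0F , (𝟘 ∷ 𝟙 ∷ 𝟙 ∷ 𝟘 ∷ 𝟘 ∷ 𝟘 ∷ 𝟘 ∷ []) , (𝟘 ∷ 𝟘 ∷ 𝟘 ∷ 𝟙 ∷ 𝟙 ∷ 𝟘 ∷ 𝟘 ∷ []) , (𝟘 ∷ 𝟘 ∷ 𝟘 ∷ 𝟘 ∷ 𝟘 ∷ 𝟙 ∷ 𝟙 ∷ [])
witnessTable (𝟙 ∷ 𝟚 ∷ 𝟙 ∷ 𝟙 ∷ 𝟚 ∷ 𝟚 ∷ 𝟙 ∷ []) = 0F , (𝟘 ∷ 𝟙 ∷ 𝟙 ∷ 𝟘 ∷ 𝟘 ∷ 𝟘 ∷ 𝟘 ∷ []) , (𝟘 ∷ 𝟘 ∷ 𝟘 ∷ 𝟙 ∷ 𝟙 ∷ 𝟘 ∷ 𝟘 ∷ []) , (𝟘 ∷ 𝟘 ∷ 𝟘 ∷ 𝟘 ∷ 𝟘 ∷ 𝟙 ∷ 𝟙 ∷ [])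
witnessTable (𝟙 ∷ 𝟚 ∷ 𝟙 ∷ 𝟙 ∷ 𝟚 ∷ 𝟚 ∷ 𝟚 ∷ []) = 1F , (𝟙 ∷ 𝟘 ∷ 𝟘 ∷ 𝟘 ∷ 𝟙 ∷ 𝟘 ∷ 𝟘 ∷ []) , (𝟘 ∷ 𝟘 ∷ 𝟙 ∷ 𝟘 ∷ 𝟘 ∷ 𝟙 ∷ 𝟘 ∷ []) , (𝟘 ∷ 𝟘 ∷ 𝟘 ∷ 𝟙 ∷ 𝟘 ∷ 𝟘 ∷ 𝟙 ∷ [])
witnessTable (𝟙 ∷ 𝟚 ∷ 𝟙 ∷ 𝟚 ∷ 𝟙 ∷ 𝟙 ∷ 𝟙 ∷ []) = 1F , (𝟙 ∷ 𝟘 ∷ 𝟘 ∷ 𝟙 ∷ 𝟘 ∷ 𝟘 ∷ 𝟘 ∷ []) , (𝟘 ∷ 𝟘 ∷ 𝟙 ∷ 𝟘 ∷ 𝟙 ∷ 𝟙 ∷ 𝟘 ∷ []) , (𝟘 ∷ 𝟘 ∷ 𝟙 ∷ 𝟘 ∷ 𝟚 ∷ 𝟘 ∷ 𝟙 ∷ [])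
witnessTable (𝟙 ∷ 𝟚 ∷ 𝟙 ∷ 𝟚 ∷ 𝟙 ∷ 𝟙 ∷ 𝟚 ∷ []) = 0F , (𝟘 ∷ 𝟙 ∷ 𝟙 ∷ 𝟘 ∷ 𝟘 ∷ 𝟘 ∷ 𝟘 ∷ []) , (𝟘 ∷ 𝟘 ∷ 𝟘 ∷ 𝟙 ∷ 𝟙 ∷ 𝟘 ∷ 𝟘 ∷ []) , (𝟘 ∷ 𝟘 ∷ 𝟘 ∷ 𝟘 ∷ 𝟘 ∷ 𝟙 ∷ 𝟙 ∷ [])
witnessTable (𝟙 ∷ 𝟚 ∷ 𝟙 ∷ 𝟚 ∷ 𝟙 ∷ 𝟚 ∷ 𝟙 ∷ []) = 0F , (𝟘 ∷ 𝟙 ∷ 𝟙 ∷ 𝟘 ∷ 𝟘 ∷ 𝟘 ∷ 𝟘 ∷ []) , (𝟘 ∷ 𝟘 ∷ 𝟘 ∷ 𝟙 ∷ 𝟙 ∷ 𝟘 ∷ 𝟘 ∷ []) , (𝟘 ∷ 𝟘 ∷ 𝟘 ∷ 𝟘 ∷ 𝟘 ∷ 𝟙 ∷ 𝟙 ∷ [])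
witnessTable (𝟙 ∷ 𝟚 ∷ 𝟙 ∷ 𝟚 ∷ 𝟙 ∷ 𝟚 ∷ 𝟚 ∷ []) = 1F , (𝟙 ∷ 𝟘 ∷ 𝟘 ∷ 𝟙 ∷ 𝟘 ∷ 𝟘 ∷ 𝟘 ∷ []) , (𝟘 ∷ 𝟘 ∷ 𝟙 ∷ 𝟘 ∷ 𝟘 ∷ 𝟙 ∷ 𝟘 ∷ []) , (𝟘 ∷ 𝟘 ∷ 𝟘 ∷ 𝟘 ∷ 𝟙 ∷ 𝟘 ∷ 𝟙 ∷ [])
witnessTable (𝟙 ∷ 𝟚 ∷ 𝟙 ∷ 𝟚 ∷ 𝟚 ∷ 𝟙 ∷ 𝟙 ∷ []) = 0F , (𝟘 ∷ 𝟙 ∷ 𝟙 ∷ 𝟘 ∷ 𝟘 ∷ 𝟘 ∷ 𝟘 ∷ []) , (𝟘 ∷ 𝟘 ∷ 𝟘 ∷ 𝟙 ∷ 𝟘 ∷ 𝟙 ∷ 𝟘 ∷ []) , (𝟘 ∷ 𝟘 ∷ 𝟘 ∷ 𝟘 ∷ 𝟙 ∷ 𝟘 ∷ 𝟙 ∷ [])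
witnessTable (𝟙 ∷ 𝟚 ∷ 𝟙 ∷ 𝟚 ∷ 𝟚 ∷ 𝟙 ∷ 𝟚 ∷ []) = 1F , (𝟙 ∷ 𝟘 ∷ 𝟘 ∷ 𝟙 ∷ 𝟘 ∷ 𝟘 ∷ 𝟘 ∷ []) , (𝟘 ∷ 𝟘 ∷ 𝟙 ∷ 𝟘 ∷ 𝟙 ∷ 𝟘 ∷ 𝟘 ∷ []) , (𝟘 ∷ 𝟘 ∷ 𝟘 ∷ 𝟘 ∷ 𝟘 ∷ 𝟙 ∷ 𝟙 ∷ [])
witnessTable (𝟙 ∷ 𝟚 ∷ 𝟙 ∷ 𝟚 ∷ 𝟚 ∷ 𝟚 ∷ 𝟙 ∷ []) = 1F , (𝟙 ∷ 𝟘 ∷ 𝟘 ∷ 𝟙 ∷ 𝟘 ∷ 𝟘 ∷ 𝟘 ∷ []) , (𝟘 ∷ 𝟘 ∷ 𝟙 ∷ 𝟘 ∷ 𝟙 ∷ 𝟘 ∷ 𝟘 ∷ []) , (𝟘 ∷ 𝟘 ∷ 𝟘 ∷ 𝟘 ∷ 𝟘 ∷ 𝟙 ∷ 𝟙 ∷ [])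
witnessTable (𝟙 ∷ 𝟚 ∷ 𝟙 ∷ 𝟚 ∷ 𝟚 ∷ 𝟚 ∷ 𝟚 ∷ []) = 0F , (𝟘 ∷ 𝟙 ∷ 𝟙 ∷ 𝟘 ∷ 𝟘 ∷ 𝟘 ∷ 𝟘 ∷ []) , (𝟘 ∷ 𝟘 ∷ 𝟘 ∷ 𝟙 ∷ 𝟙 ∷ 𝟙 ∷ 𝟘 ∷ []) , (𝟘 ∷ 𝟘 ∷ 𝟘 ∷ 𝟙 ∷ 𝟚 ∷ 𝟘 ∷ 𝟙 ∷ [])
witnessTable (𝟙 ∷ 𝟚 ∷ 𝟚 ∷ 𝟙 ∷ 𝟙 ∷ 𝟙 ∷ 𝟙 ∷ []) = 1F , (𝟙 ∷ 𝟘 ∷ 𝟙 ∷ 𝟘 ∷ 𝟘 ∷ 𝟘 ∷ 𝟘 ∷ []) , (𝟘 ∷ 𝟘 ∷ 𝟘 ∷ 𝟙 ∷ 𝟙 ∷ 𝟙 ∷ 𝟘 ∷ []) , (𝟘 ∷ 𝟘 ∷ 𝟘 ∷ 𝟙 ∷ 𝟚 ∷ 𝟘 ∷ 𝟙 ∷ [])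
witnessTable (𝟙 ∷ 𝟚 ∷ 𝟚 ∷ 𝟙 ∷ 𝟙 ∷ 𝟙 ∷ 𝟚 ∷ []) = 0F , (𝟘 ∷ 𝟙 ∷ 𝟘 ∷ 𝟙 ∷ 𝟘 ∷ 𝟘 ∷ 𝟘 ∷ []) , (𝟘 ∷ 𝟘 ∷ 𝟙 ∷ 𝟘 ∷ 𝟙 ∷ 𝟘 ∷ 𝟘 ∷ []) , (𝟘 ∷ 𝟘 ∷ 𝟘 ∷ 𝟘 ∷ 𝟘 ∷ 𝟙 ∷ 𝟙 ∷ [])
witnessTable (𝟙 ∷ 𝟚 ∷ 𝟚 ∷ 𝟙 ∷ 𝟙 ∷ 𝟚 ∷ 𝟙 ∷ []) = 0F , (𝟘 ∷ 𝟙 ∷ 𝟘 ∷ 𝟙 ∷ 𝟘 ∷ 𝟘 ∷ 𝟘 ∷ []) , (𝟘 ∷ 𝟘 ∷ 𝟙 ∷ 𝟘 ∷ 𝟙 ∷ 𝟘 ∷ 𝟘 ∷ []) , (𝟘 ∷ 𝟘 ∷ 𝟘 ∷ 𝟘 ∷ 𝟘 ∷ 𝟙 ∷ 𝟙 ∷ [])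
witnessTable (𝟙 ∷ 𝟚 ∷ 𝟚 ∷ 𝟙 ∷ 𝟙 ∷ 𝟚 ∷ 𝟚 ∷ []) = 1F , (𝟙 ∷ 𝟘 ∷ 𝟙 ∷ 𝟘 ∷ 𝟘 ∷ 𝟘 ∷ 𝟘 ∷ []) , (𝟘 ∷ 𝟘 ∷ 𝟘 ∷ 𝟙 ∷ 𝟘 ∷ 𝟙 ∷ 𝟘 ∷ []) , (𝟘 ∷ 𝟘 ∷ 𝟘 ∷ 𝟘 ∷ 𝟙 ∷ 𝟘 ∷ 𝟙 ∷ [])
witnessTable (𝟙 ∷ 𝟚 ∷ 𝟚 ∷ 𝟙 ∷ 𝟚 ∷ 𝟙 ∷ 𝟙 ∷ []) = 0F , (𝟘 ∷ 𝟙 ∷ 𝟘 ∷ 𝟙 ∷ 𝟘 ∷ 𝟘 ∷ 𝟘 ∷ []) , (𝟘 ∷ 𝟘 ∷ 𝟙 ∷ 𝟘 ∷ 𝟘 ∷ 𝟙 ∷ 𝟘 ∷ []) , (𝟘 ∷ 𝟘 ∷ 𝟘 ∷ 𝟘 ∷ 𝟙 ∷ 𝟘 ∷ 𝟙 ∷ [])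
witnessTable (𝟙 ∷ 𝟚 ∷ 𝟚 ∷ 𝟙 ∷ 𝟚 ∷ 𝟙 ∷ 𝟚 ∷ []) = 1F , (𝟙 ∷ 𝟘 ∷ 𝟙 ∷ 𝟘 ∷ 𝟘 ∷ 𝟘 ∷ 𝟘 ∷ []) , (𝟘 ∷ 𝟘 ∷ 𝟘 ∷ 𝟙 ∷ 𝟙 ∷ 𝟘 ∷ 𝟘 ∷ []) , (𝟘 ∷ 𝟘 ∷ 𝟘 ∷ 𝟘 ∷ 𝟘 ∷ 𝟙 ∷ 𝟙 ∷ [])
witnessTable (𝟙 ∷ 𝟚 ∷ 𝟚 ∷ 𝟙 ∷ 𝟚 ∷ 𝟚 ∷ 𝟙 ∷ []) = 1F , (𝟙 ∷ 𝟘 ∷ 𝟙 ∷ 𝟘 ∷ 𝟘 ∷ 𝟘 ∷ 𝟘 ∷ []) , (𝟘 ∷ 𝟘 ∷ 𝟘 ∷ 𝟙 ∷ 𝟙 ∷ 𝟘 ∷ 𝟘 ∷ []) , (𝟘 ∷ 𝟘 ∷ 𝟘 ∷ 𝟘 ∷ 𝟘 ∷ 𝟙 ∷ 𝟙 ∷ [])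
witnessTable (𝟙 ∷ 𝟚 ∷ 𝟚 ∷ 𝟙 ∷ 𝟚 ∷ 𝟚 ∷ 𝟚 ∷ []) = 0F , (𝟘 ∷ 𝟙 ∷ 𝟘 ∷ 𝟙 ∷ 𝟘 ∷ 𝟘 ∷ 𝟘 ∷ []) , (𝟘 ∷ 𝟘 ∷ 𝟙 ∷ 𝟘 ∷ 𝟙 ∷ 𝟙 ∷ 𝟘 ∷ []) , (𝟘 ∷ 𝟘 ∷ 𝟙 ∷ 𝟘 ∷ 𝟚 ∷ 𝟘 ∷ 𝟙 ∷ [])
witnessTable (𝟙 ∷ 𝟚 ∷ 𝟚 ∷ 𝟚 ∷ 𝟙 ∷ 𝟙 ∷ 𝟙 ∷ []) = 0F , (𝟘 ∷ 𝟙 ∷ 𝟘 ∷ 𝟘 ∷ 𝟙 ∷ 𝟘 ∷ 𝟘 ∷ []) , (𝟘 ∷ 𝟘 ∷ 𝟙 ∷ 𝟘 ∷ 𝟘 ∷ 𝟙 ∷ 𝟘 ∷ []) , (𝟘 ∷ 𝟘 ∷ 𝟘 ∷ 𝟙 ∷ 𝟘 ∷ 𝟘 ∷ 𝟙 ∷ [])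
witnessTable (𝟙 ∷ 𝟚 ∷ 𝟚 ∷ 𝟚 ∷ 𝟙 ∷ 𝟙 ∷ 𝟚 ∷ []) = 1F , (𝟙 ∷ 𝟘 ∷ 𝟙 ∷ 𝟘 ∷ 𝟘 ∷ 𝟘 ∷ 𝟘 ∷ []) , (𝟘 ∷ 𝟘 ∷ 𝟘 ∷ 𝟙 ∷ 𝟙 ∷ 𝟘 ∷ 𝟘 ∷ []) , (𝟘 ∷ 𝟘 ∷ 𝟘 ∷ 𝟘 ∷ 𝟘 ∷ 𝟙 ∷ 𝟙 ∷ [])
witnessTable (𝟙 ∷ 𝟚 ∷ 𝟚 ∷ 𝟚 ∷ 𝟙 ∷ 𝟚 ∷ 𝟙 ∷ []) = 1F , (𝟙 ∷ 𝟘 ∷ 𝟙 ∷ 𝟘 ∷ 𝟘 ∷ 𝟘 ∷ 𝟘 ∷ []) , (𝟘 ∷ 𝟘 ∷ 𝟘 ∷ 𝟙 ∷ 𝟙 ∷ 𝟘 ∷ 𝟘 ∷ []) , (𝟘 ∷ 𝟘 ∷ 𝟘 ∷ 𝟘 ∷ 𝟘 ∷ 𝟙 ∷ 𝟙 ∷ [])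
witnessTable (𝟙 ∷ 𝟚 ∷ 𝟚 ∷ 𝟚 ∷ 𝟙 ∷ 𝟚 ∷ 𝟚 ∷ []) = 0F , (𝟘 ∷ 𝟙 ∷ 𝟘 ∷ 𝟘 ∷ 𝟙 ∷ 𝟘 ∷ 𝟘 ∷ []) , (𝟘 ∷ 𝟘 ∷ 𝟙 ∷ 𝟙 ∷ 𝟘 ∷ 𝟙 ∷ 𝟘 ∷ []) , (𝟘 ∷ 𝟘 ∷ 𝟙 ∷ 𝟚 ∷ 𝟘 ∷ 𝟘 ∷ 𝟙 ∷ [])
witnessTable (𝟙 ∷ 𝟚 ∷ 𝟚 ∷ 𝟚 ∷ 𝟚 ∷ 𝟙 ∷ 𝟙 ∷ []) = 1F , (𝟙 ∷ 𝟘 ∷ 𝟙 ∷ 𝟘 ∷ 𝟘 ∷ 𝟘 ∷ 𝟘 ∷ []) , (𝟘 ∷ 𝟘 ∷ 𝟘 ∷ 𝟙 ∷ 𝟘 ∷ 𝟙 ∷ 𝟘 ∷ []) , (𝟘 ∷ 𝟘 ∷ 𝟘 ∷ 𝟘 ∷ 𝟙 ∷ 𝟘 ∷ 𝟙 ∷ [])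
witnessTable (𝟙 ∷ 𝟚 ∷ 𝟚 ∷ 𝟚 ∷ 𝟚 ∷ 𝟙 ∷ 𝟚 ∷ []) = 0F , (𝟘 ∷ 𝟙 ∷ 𝟘 ∷ 𝟘 ∷ 𝟘 ∷ 𝟙 ∷ 𝟘 ∷ []) , (𝟘 ∷ 𝟘 ∷ 𝟙 ∷ 𝟙 ∷ 𝟙 ∷ 𝟘 ∷ 𝟘 ∷ []) , (𝟘 ∷ 𝟘 ∷ 𝟙 ∷ 𝟚 ∷ 𝟘 ∷ 𝟘 ∷ 𝟙 ∷ [])
witnessTable (𝟙 ∷ 𝟚 ∷ 𝟚 ∷ 𝟚 ∷ 𝟚 ∷ 𝟚 ∷ 𝟙 ∷ []) = 0F , (𝟘 ∷ 𝟙 ∷ 𝟘 ∷ 𝟘 ∷ 𝟘 ∷ 𝟘 ∷ 𝟙 ∷ []) , (𝟘 ∷ 𝟘 ∷ 𝟙 ∷ 𝟙 ∷ 𝟙 ∷ 𝟘 ∷ 𝟘 ∷ []) , (𝟘 ∷ 𝟘 ∷ 𝟙 ∷ 𝟚 ∷ 𝟘 ∷ 𝟙 ∷ 𝟘 ∷ [])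
witnessTable (𝟙 ∷ 𝟚 ∷ 𝟚 ∷ 𝟚 ∷ 𝟚 ∷ 𝟚 ∷ 𝟚 ∷ []) = 1F , (𝟙 ∷ 𝟘 ∷ 𝟙 ∷ 𝟘 ∷ 𝟘 ∷ 𝟘 ∷ 𝟘 ∷ []) , (𝟘 ∷ 𝟘 ∷ 𝟘 ∷ 𝟙 ∷ 𝟙 ∷ 𝟙 ∷ 𝟘 ∷ []) , (𝟘 ∷ 𝟘 ∷ 𝟘 ∷ 𝟙 ∷ 𝟚 ∷ 𝟘 ∷ 𝟙 ∷ [])
witnessTable _ = zero , 0ᵛ , 0ᵛ , 0ᵛ

-- Multiplying the weights by 𝟚 changes neither the singular vectors nor
-- orthogonality, so the table only needs patterns starting with 𝟙.
planeWitness : Vec F3 7 → PlaneData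
planeWitness D = witnessTable (head D ∙ᵛ D)

allIdx : Vec (Fin 7) 7
allIdx = allFin 7

ValidPlane : Vec F3 7 → PlaneData → Set
ValidPlane D (i , u , v , w) =
  (∀ a b c → (a ≡ 𝟘 × b ≡ 𝟘 × c ≡ 𝟘) ⊎ ∃ λ k → diagForm (lookup D) (k ∷ []) (𝟙 ∷ []) allIdx (comb₃ a u b v c w) ≢ 𝟘)
  × (∀ a b c → diagForm (lookup D) (i ∷ []) (𝟙 ∷ []) allIdx (comb₃ a u b v c w) ≡ 𝟘
             × diagForm (lookup D) allIdx (comb₃ a u b v c w) allIdx (comb₃ a u b v c w) ≡ 𝟘)

validPlane? : ∀ D p → Dec (ValidPlane D p)
validPlane? D (i , u , v , w) =
  (∀₃? λ a → ∀₃? λ b → ∀₃? λ c → (a ≟₃ 𝟘 ×-dec b ≟₃ 𝟘 ×-dec c ≟₃ 𝟘)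
     ⊎-dec Finₚ.any? λ k → ¬? (diagForm (lookup D) (k ∷ []) (𝟙 ∷ []) allIdx (comb₃ a u b v c w) ≟₃ 𝟘))
  ×-dec (∀₃? λ a → ∀₃? λ b → ∀₃? λ c → diagForm (lookup D) (i ∷ []) (𝟙 ∷ []) allIdx (comb₃ a u b v c w) ≟₃ 𝟘
     ×-dec diagForm (lookup D) allIdx (comb₃ a u b v c w) allIdx (comb₃ a u b v c w) ≟₃ 𝟘)

abstract
  weights-constant-or-plane : ∀ D → (∀ k → lookup D k ≢ 𝟘) →
                              (∀ k → lookup D k ≡ lookup D zero) ⊎ ValidPlane D (planeWitness D)
  weights-constant-or-plane = toWitness {a? = ∀ᵛ? λ D → Finₚ.all? (λ k → ¬? (lookup D k ≟₃ 𝟘)) →-dec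
    (Finₚ.all? (λ k → lookup D k ≟₃ lookup D zero) ⊎-dec validPlane? D (planeWitness D))} _

module Simplex (A : Mat) (sym-A : Symmetric A) (P : Fin 7 → Vec7) (self-polar : SelfPolarSimplex A P) where

  span : ∀ {n} → Vec (Fin 7) n → Vec F3 n → Vec7
  span [] [] = 𝟎
  span (i ∷ X) (y ∷ ys) = y ⊙ P i ⊕ span X ys

  span-comb : ∀ {n} (X : Vec (Fin 7) n) a y b z → a ⊙ span X y ⊕ b ⊙ span X z ≡ span X (comb a y b z)
  span-comb [] a [] b [] = trans (cong₂ _⊕_ (∙ᵛ-zeroʳ a) (∙ᵛ-zeroʳ b)) (+ᵛ-identityˡ 𝟎)
  span-comb (i ∷ X) a (y ∷ ys) b (z ∷ zs) =
    trans (regroup (P i) (span X ys) (span X zs)) (cong ((a *₃ y +₃ b *₃ z) ⊙ P i ⊕_) (span-comb X a ys b zs))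
    where
    regroup : ∀ {n} (p s s′ : Vec F3 n) →
              a ∙ᵛ (y ∙ᵛ p +ᵛ s) +ᵛ b ∙ᵛ (z ∙ᵛ p +ᵛ s′) ≡ (a *₃ y +₃ b *₃ z) ∙ᵛ p +ᵛ (a ∙ᵛ s +ᵛ b ∙ᵛ s′)
    regroup [] [] [] = refl
    regroup (p ∷ ps) (s ∷ ss) (s′ ∷ ss′) = cong₂ _∷_ (scalar a b y z p s s′) (regroup ps ss ss′)
      where
      scalar : ∀ a b y z p s s′ → a *₃ (y *₃ p +₃ s) +₃ b *₃ (z *₃ p +₃ s′) ≡ (a *₃ y +₃ b *₃ z) *₃ p +₃ (a *₃ s +₃ b *₃ s′)
      scalar = solve-∀ F3-ring

  span-single : ∀ k → span (k ∷ []) (𝟙 ∷ []) ≡ P k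
  span-single k = trans (+ᵛ-identityʳ (𝟙 ⊙ P k)) (∙ᵛ-identityˡ (P k))

  orthogonal : ∀ {i j} → i ≢ j → bil A (P i) (P j) ≡ 𝟘
  orthogonal {i} {j} i≢j =
    proj₂ (self-polar i (P j)) ((λ k → δ j k 𝟙) , δ-off 𝟙 (λ j≡i → i≢j (sym j≡i)) , sym (combination-unit j P))

  module Weights (w : Fin 7 → F3) (quad≡w : ∀ k → quad A (P k) ≡ w k) where

    bil-P-P : ∀ j i → bil A (P j) (P i) ≡ δ j i (w i)
    bil-P-P j i with j Finₚ.≟ i
    ... | yes refl = trans (quad≡w i) (sym (δ-diagonal i (w i)))
    ... | no j≢i = trans (orthogonal j≢i) (sym (δ-off (w i) j≢i))

    bil-P-span : ∀ {n} i (Y : Vec (Fin 7) n) z → bil A (P i) (span Y z) ≡ diagRow (w i) i Y z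
    bil-P-span i [] [] = trans (bil-sym A sym-A (P i) 𝟎) (bil-0ˡ A (P i))
    bil-P-span i (j ∷ Y) (z ∷ zs) = begin
      bil A (P i) (z ⊙ P j ⊕ span Y zs)               ≡⟨ bil-sym A sym-A (P i) (z ⊙ P j ⊕ span Y zs) ⟩
      bil A (z ⊙ P j ⊕ span Y zs) (P i)               ≡⟨ bil-+ˡ A (z ⊙ P j) (span Y zs) (P i) ⟩
      bil A (z ⊙ P j) (P i) +₃ bil A (span Y zs) (P i) ≡⟨ cong₂ _+₃_ (bil-∙ˡ A z (P j) (P i)) (bil-sym A sym-A (span Y zs) (P i)) ⟩
      z *₃ bil A (P j) (P i) +₃ bil A (P i) (span Y zs) ≡⟨ cong₂ (λ s t → z *₃ s +₃ t) (bil-P-P j i) (bil-P-span i Y zs) ⟩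
      z *₃ δ j i (w i) +₃ diagRow (w i) i Y zs             ≡⟨ cong (_+₃ diagRow (w i) i Y zs) (*₃-comm z _) ⟩
      δ j i (w i) *₃ z +₃ diagRow (w i) i Y zs             ∎
      where open ≡-Reasoning

    bil-span : ∀ {m n} (X : Vec (Fin 7) m) y (Y : Vec (Fin 7) n) z → bil A (span X y) (span Y z) ≡ diagForm w X y Y z
    bil-span [] [] Y z = bil-0ˡ A (span Y z)
    bil-span (i ∷ X) (y ∷ ys) Y z =
      trans (bil-+ˡ A (y ⊙ P i) (span X ys) (span Y z))
            (cong₂ _+₃_ (trans (bil-∙ˡ A y (P i) (span Y z)) (cong (y *₃_) (bil-P-span i Y z))) (bil-span X ys Y z))

  span-comb₃ : ∀ {n} (X : Vec (Fin 7) n) a y b z c v →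
               a ⊙ span X y ⊕ b ⊙ span X z ⊕ c ⊙ span X v ≡ span X (comb₃ a y b z c v)
  span-comb₃ X a y b z c v = begin
    a ⊙ span X y ⊕ b ⊙ span X z ⊕ c ⊙ span X v    ≡⟨ cong (_⊕ c ⊙ span X v) (span-comb X a y b z) ⟩
    span X (comb a y b z) ⊕ c ⊙ span X v           ≡⟨ cong (_⊕ c ⊙ span X v) (sym (∙ᵛ-identityˡ _)) ⟩
    𝟙 ⊙ span X (comb a y b z) ⊕ c ⊙ span X v       ≡⟨ span-comb X 𝟙 (comb a y b z) c v ⟩
    span X (comb 𝟙 (comb a y b z) c v)             ≡⟨ cong (λ t → span X (t +ᵛ c ∙ᵛ v)) (∙ᵛ-identityˡ _) ⟩
    span X (comb₃ a y b z c v)                     ∎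
    where open ≡-Reasoning

  planeOf : PlaneData → Plane
  planeOf (_ , u , v , w) = span allIdx u , span allIdx v , span allIdx w

  witness-plane : ∀ D → (∀ k → quad A (P k) ≡ lookup D k) → ∀ p → ValidPlane D p → IsPlaneIn A (perp A (P (proj₁ p))) (planeOf p)
  witness-plane D quad≡D (i , u , v , w) (nonzero , singular) = independent , in-perp , isotropic
    where
    open Weights (lookup D) quad≡D
    point : ∀ a b c → a ⊙ span allIdx u ⊕ b ⊙ span allIdx v ⊕ c ⊙ span allIdx w ≡ span allIdx (comb₃ a u b v c w)
    point a b c = span-comb₃ allIdx a u b v c w
    independent : Indep3 (span allIdx u) (span allIdx v) (span allIdx w)
    independent a b c vanishes with nonzero a b c
    ... | inj₁ zeros = zeros
    ... | inj₂ (k , pairs-nonzero) = ⊥-elim (pairs-nonzero (begin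
      diagForm (lookup D) (k ∷ []) (𝟙 ∷ []) allIdx (comb₃ a u b v c w) ≡⟨ sym (bil-span (k ∷ []) (𝟙 ∷ []) allIdx (comb₃ a u b v c w)) ⟩
      bil A (span (k ∷ []) (𝟙 ∷ [])) (span allIdx (comb₃ a u b v c w)) ≡⟨ cong (bil A (span (k ∷ []) (𝟙 ∷ []))) (trans (sym (point a b c)) vanishes) ⟩
      bil A (span (k ∷ []) (𝟙 ∷ [])) 𝟎                                 ≡⟨ bil-sym A sym-A (span (k ∷ []) (𝟙 ∷ [])) 𝟎 ⟩
      bil A 𝟎 (span (k ∷ []) (𝟙 ∷ []))                                 ≡⟨ bil-0ˡ A (span (k ∷ []) (𝟙 ∷ [])) ⟩
      𝟘                                                                 ∎))
      where open ≡-Reasoning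
    in-perp : ∀ a b c → perp A (P i) (a ⊙ span allIdx u ⊕ b ⊙ span allIdx v ⊕ c ⊙ span allIdx w)
    in-perp a b c = trans (cong₂ (bil A) (sym (span-single i)) (point a b c))
                          (trans (bil-span (i ∷ []) (𝟙 ∷ []) allIdx (comb₃ a u b v c w)) (proj₁ (singular a b c)))
    isotropic : ∀ a b c → quad A (a ⊙ span allIdx u ⊕ b ⊙ span allIdx v ⊕ c ⊙ span allIdx w) ≡ 𝟘
    isotropic a b c = trans (cong (λ t → bil A t t) (point a b c))
                            (trans (bil-span allIdx (comb₃ a u b v c w) allIdx (comb₃ a u b v c w)) (proj₂ (singular a b c)))

  uniform-weights : (∀ k → Internal A (P k)) → ∃ λ c → c ≢ 𝟘 × (∀ k → quad A (P k) ≡ c)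
  uniform-weights internal = conclude (weights-constant-or-plane D D-nonzero)
    where
    D : Vec F3 7
    D = tabulate λ k → quad A (P k)
    quad≡D : ∀ k → quad A (P k) ≡ lookup D k
    quad≡D k = sym (lookup∘tabulate (λ k → quad A (P k)) k)
    D-nonzero : ∀ k → lookup D k ≢ 𝟘
    D-nonzero k D≡𝟘 = proj₁ (internal k) (trans (quad≡D k) D≡𝟘)
    conclude : (∀ k → lookup D k ≡ lookup D zero) ⊎ ValidPlane D (planeWitness D) → ∃ λ c → c ≢ 𝟘 × (∀ k → quad A (P k) ≡ c)
    conclude (inj₁ constant) = lookup D zero , D-nonzero zero , λ k → trans (quad≡D k) (constant k)
    conclude (inj₂ valid) = ⊥-elim (proj₂ (proj₂ (internal (proj₁ (planeWitness D)))) (_ , witness-plane D quad≡D (planeWitness D) valid))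

Vec4 : Set
Vec4 = Vec F3 4

OnSpan : ∀ {n} → Vec F3 n × Vec F3 n → Vec F3 n → Set
OnSpan (u , v) x = ∃₂ λ a b → x ≡ comb a u b v

Independent : ∀ {n} → Vec F3 n × Vec F3 n → Set
Independent (u , v) = ∀ a b → comb a u b v ≡ 0ᵛ → a ≡ 𝟘 × b ≡ 𝟘

Isotropic : ∀ {n} → Vec F3 n × Vec F3 n → Set
Isotropic (u , v) = ∀ a b → dot (comb a u b v) (comb a u b v) ≡ 𝟘

SameSpan : ∀ {n} → Vec F3 n × Vec F3 n → Vec F3 n × Vec F3 n → Set
SameSpan (u , v) (u′ , v′) = (OnSpan (u′ , v′) u × OnSpan (u′ , v′) v) × (OnSpan (u , v) u′ × OnSpan (u , v) v′)

PerpFree : ∀ {m n} → (Vec F3 m → Vec F3 n → F3) → Vec F3 n × Vec F3 n → Vec F3 m × Vec F3 m → Set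
PerpFree β (u , v) (u′ , v′) = ∀ a b → β (comb a u′ b v′) u ≡ 𝟘 → β (comb a u′ b v′) v ≡ 𝟘 → a ≡ 𝟘 × b ≡ 𝟘

onSpan? : ∀ {n} l (x : Vec F3 n) → Dec (OnSpan l x)
onSpan? (u , v) x = ∃₃? λ a → ∃₃? λ b → x ≟ᵛ comb a u b v

independent? : ∀ {n} (l : Vec F3 n × Vec F3 n) → Dec (Independent l)
independent? (u , v) = ∀₃? λ a → ∀₃? λ b → comb a u b v ≟ᵛ 0ᵛ →-dec (a ≟₃ 𝟘 ×-dec b ≟₃ 𝟘)

isotropic? : ∀ {n} (l : Vec F3 n × Vec F3 n) → Dec (Isotropic l)
isotropic? (u , v) = ∀₃? λ a → ∀₃? λ b → dot (comb a u b v) (comb a u b v) ≟₃ 𝟘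

sameSpan? : ∀ {n} (l m : Vec F3 n × Vec F3 n) → Dec (SameSpan l m)
sameSpan? (u , v) (u′ , v′) =
  (onSpan? (u′ , v′) u ×-dec onSpan? (u′ , v′) v) ×-dec (onSpan? (u , v) u′ ×-dec onSpan? (u , v) v′)

perpFree? : ∀ {m n} (β : Vec F3 m → Vec F3 n → F3) l m′ → Dec (PerpFree β l m′)
perpFree? β (u , v) (u′ , v′) =
  ∀₃? λ a → ∀₃? λ b → β (comb a u′ b v′) u ≟₃ 𝟘 →-dec (β (comb a u′ b v′) v ≟₃ 𝟘 →-dec (a ≟₃ 𝟘 ×-dec b ≟₃ 𝟘))

-- The quadric y₀² + y₁² + y₂² + y₃² = 0 of PG(3,3) is hyperbolic; these are
-- its two reguli (κ) of four lines (j) each.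
modelLine : Fin 2 → Fin 4 → Vec4 × Vec4
modelLine 0F 0F = (𝟘 ∷ 𝟙 ∷ 𝟙 ∷ 𝟙 ∷ []) , (𝟙 ∷ 𝟘 ∷ 𝟙 ∷ 𝟚 ∷ [])
modelLine 0F 1F = (𝟘 ∷ 𝟙 ∷ 𝟙 ∷ 𝟚 ∷ []) , (𝟙 ∷ 𝟘 ∷ 𝟚 ∷ 𝟚 ∷ [])
modelLine 0F 2F = (𝟘 ∷ 𝟙 ∷ 𝟚 ∷ 𝟙 ∷ []) , (𝟙 ∷ 𝟘 ∷ 𝟙 ∷ 𝟙 ∷ [])
modelLine 0F 3F = (𝟘 ∷ 𝟙 ∷ 𝟚 ∷ 𝟚 ∷ []) , (𝟙 ∷ 𝟘 ∷ 𝟚 ∷ 𝟙 ∷ [])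
modelLine 1F 0F = (𝟘 ∷ 𝟙 ∷ 𝟙 ∷ 𝟙 ∷ []) , (𝟙 ∷ 𝟘 ∷ 𝟚 ∷ 𝟙 ∷ [])
modelLine 1F 1F = (𝟘 ∷ 𝟙 ∷ 𝟙 ∷ 𝟚 ∷ []) , (𝟙 ∷ 𝟘 ∷ 𝟙 ∷ 𝟙 ∷ [])
modelLine 1F 2F = (𝟘 ∷ 𝟙 ∷ 𝟚 ∷ 𝟙 ∷ []) , (𝟙 ∷ 𝟘 ∷ 𝟚 ∷ 𝟚 ∷ [])
modelLine 1F 3F = (𝟘 ∷ 𝟙 ∷ 𝟚 ∷ 𝟚 ∷ []) , (𝟙 ∷ 𝟘 ∷ 𝟙 ∷ 𝟚 ∷ [])

-- Abstract, so that using these facts never re-runs the decision procedures.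
abstract
  modelLine-independent : ∀ κ j → Independent (modelLine κ j)
  modelLine-independent = toWitness {a? = Finₚ.all? λ κ → Finₚ.all? λ j → independent? (modelLine κ j)} _

  modelLine-isotropic : ∀ κ j → Isotropic (modelLine κ j)
  modelLine-isotropic = toWitness {a? = Finₚ.all? λ κ → Finₚ.all? λ j → isotropic? (modelLine κ j)} _

  isotropic-line-is-modelLine : ∀ (u v : Vec4) → Independent (u , v) → Isotropic (u , v) → ∃₂ λ κ j → SameSpan (u , v) (modelLine κ j)
  isotropic-line-is-modelLine = toWitness {a? = ∀ᵛ? λ u → ∀ᵛ? λ v → independent? (u , v) →-dec (isotropic? (u , v) →-dec
    Finₚ.any? λ κ → Finₚ.any? λ j → sameSpan? (u , v) (modelLine κ j))} _

  modelLine-injective : ∀ κ j κ′ j′ → SameSpan (modelLine κ j) (modelLine κ′ j′) → κ ≡ κ′ × j ≡ j′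
  modelLine-injective = toWitness {a? = Finₚ.all? λ κ → Finₚ.all? λ j → Finₚ.all? λ κ′ → Finₚ.all? λ j′ →
    sameSpan? (modelLine κ j) (modelLine κ′ j′) →-dec (κ Finₚ.≟ κ′ ×-dec j Finₚ.≟ j′)} _

  modelLines-meet : ∀ κ j κ′ j′ → κ ≢ κ′ →
    ∃₂ λ a b → ¬ (a ≡ 𝟘 × b ≡ 𝟘) × OnSpan (modelLine κ′ j′) (comb a (proj₁ (modelLine κ j)) b (proj₂ (modelLine κ j)))
  modelLines-meet = toWitness {a? = Finₚ.all? λ κ → Finₚ.all? λ j → Finₚ.all? λ κ′ → Finₚ.all? λ j′ → ¬? (κ Finₚ.≟ κ′) →-dec
    (∃₃? λ a → ∃₃? λ b → ¬? (a ≟₃ 𝟘 ×-dec b ≟₃ 𝟘) ×-dec onSpan? (modelLine κ′ j′) (comb a (proj₁ (modelLine κ j)) b (proj₂ (modelLine κ j))))} _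

  modelLines-skew : ∀ κ j j′ → j ≢ j′ → ∀ x → OnSpan (modelLine κ j) x → OnSpan (modelLine κ j′) x → x ≡ 0ᵛ
  modelLines-skew = toWitness {a? = Finₚ.all? λ κ → Finₚ.all? λ j → Finₚ.all? λ j′ → ¬? (j Finₚ.≟ j′) →-dec
    (∀ᵛ? λ x → onSpan? (modelLine κ j) x →-dec (onSpan? (modelLine κ j′) x →-dec x ≟ᵛ 0ᵛ))} _

  modelLines-perpFree : ∀ κ j j′ → j ≢ j′ → PerpFree dot (modelLine κ j) (modelLine κ j′)
  modelLines-perpFree = toWitness {a? = Finₚ.all? λ κ → Finₚ.all? λ j → Finₚ.all? λ j′ → ¬? (j Finₚ.≟ j′) →-dec
    perpFree? dot (modelLine κ j) (modelLine κ j′)} _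

  dot-nondegenerate : ∀ (y : Vec4) → (∀ z → dot y z ≡ 𝟘) → y ≡ 0ᵛ
  dot-nondegenerate = toWitness {a? = ∀ᵛ? λ y → (∀ᵛ? λ z → dot y z ≟₃ 𝟘) →-dec y ≟ᵛ 0ᵛ} _

OnSpan-trans : ∀ {n} {l : Vec F3 n × Vec F3 n} {u v y} → OnSpan l u → OnSpan l v → OnSpan (u , v) y → OnSpan l y
OnSpan-trans {l = p , q} (α , β , refl) (γ , δ , refl) (a , b , refl) =
  a *₃ α +₃ b *₃ γ , a *₃ β +₃ b *₃ δ , comb-comb a b α β γ δ p q

Linear : ∀ {n} → (Vec F3 n → Vec7) → Set
Linear f = ∀ a y b z → a ⊙ f y ⊕ b ⊙ f z ≡ f (comb a y b z)

mapLine : ∀ {n} → (Vec F3 n → Vec7) → Vec F3 n × Vec F3 n → Line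
mapLine f (u , v) = f u , f v

module _ {n} {f : Vec F3 n → Vec7} (f-linear : Linear f) where

  OnLine-mapLine : ∀ {l y} → OnSpan l y → OnLine (mapLine f l) (f y)
  OnLine-mapLine {u , v} (a , b , refl) = a , b , sym (f-linear a u b v)

  OnLine-mapLine⁻ : ∀ {l x} → OnLine (mapLine f l) x → ∃ λ y → OnSpan l y × x ≡ f y
  OnLine-mapLine⁻ {u , v} (a , b , refl) = comb a u b v , (a , b , refl) , f-linear a u b v

perpFree-transport : ∀ {m n} (A : Mat) {c} → c ≢ 𝟘 → (e : Vec F3 n → Vec7) {f : Vec F3 m → Vec7} → Linear f →
                     (β : Vec F3 m → Vec F3 n → F3) → (∀ w v → bil A (f w) (e v) ≡ c *₃ β w v) →
                     ∀ {l l′} → PerpFree β l l′ → DisjointFromPerp A (mapLine e l) (mapLine f l′)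
perpFree-transport A c≢𝟘 e {f} f-linear β bil≡ {u , v} {u′ , v′} free x (a , b , refl) x⊥l =
  trans (cong₂ (λ s t → s ⊙ f u′ ⊕ t ⊙ f v′) (proj₁ a,b≡𝟘) (proj₂ a,b≡𝟘)) (comb-zero (f u′) (f v′))
  where
  β≡𝟘 : ∀ t → OnLine (e u , e v) (e t) → β (comb a u′ b v′) t ≡ 𝟘
  β≡𝟘 t t∈l = *₃-cancelˡ-𝟘 c≢𝟘 (trans (sym (bil≡ (comb a u′ b v′) t))
                (trans (cong (λ s → bil A s (e t)) (sym (f-linear a u′ b v′))) (x⊥l (e t) t∈l)))
  a,b≡𝟘 : a ≡ 𝟘 × b ≡ 𝟘
  a,b≡𝟘 = free a b (β≡𝟘 u (OnLine-first (e u) (e v))) (β≡𝟘 v (OnLine-second (e u) (e v)))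

module Solid (A : Mat) (sym-A : Symmetric A) {c : F3} (c≢𝟘 : c ≢ 𝟘) (H : Subsp)
             (emb : Vec4 → Vec7) (emb-linear : Linear emb)
             (emb-isometry : ∀ y z → bil A (emb y) (emb z) ≡ c *₃ dot y z)
             (H-image : ∀ x → H x → ∃ λ y → x ≡ emb y) (emb-in-H : ∀ y → H (emb y)) where

  emb-0 : emb 0ᵛ ≡ 𝟎
  emb-0 = begin
    emb 0ᵛ                           ≡⟨ cong emb (sym (comb-zero 0ᵛ 0ᵛ)) ⟩
    emb (comb 𝟘 0ᵛ 𝟘 0ᵛ)             ≡⟨ sym (emb-linear 𝟘 0ᵛ 𝟘 0ᵛ) ⟩
    𝟘 ⊙ emb 0ᵛ ⊕ 𝟘 ⊙ emb 0ᵛ          ≡⟨ comb-zero (emb 0ᵛ) (emb 0ᵛ) ⟩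
    𝟎                                ∎
    where open ≡-Reasoning

  emb-injective : ∀ {y z} → emb y ≡ emb z → y ≡ z
  emb-injective {y} {z} ey≡ez = −ᵛ-zero⇒≡ y z (dot-nondegenerate (y −ᵛ z) dot≡𝟘)
    where
    open ≡-Reasoning
    emb-difference : emb (y −ᵛ z) ≡ 𝟎
    emb-difference = begin
      emb (y −ᵛ z)               ≡⟨ sym (emb-linear 𝟙 y 𝟚 z) ⟩
      emb y −ᵛ emb z             ≡⟨ cong (_−ᵛ emb z) ey≡ez ⟩
      emb z −ᵛ emb z             ≡⟨ −ᵛ-self (emb z) ⟩
      𝟎                          ∎
    dot≡𝟘 : ∀ t → dot (y −ᵛ z) t ≡ 𝟘
    dot≡𝟘 t = *₃-cancelˡ-𝟘 c≢𝟘 (begin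
      c *₃ dot (y −ᵛ z) t                ≡⟨ sym (emb-isometry (y −ᵛ z) t) ⟩
      bil A (emb (y −ᵛ z)) (emb t)       ≡⟨ cong (λ s → bil A s (emb t)) emb-difference ⟩
      bil A 𝟎 (emb t)                    ≡⟨ bil-0ˡ A (emb t) ⟩
      𝟘                                  ∎)

  OnLine⇒OnSpan : ∀ {l y} → OnLine (mapLine emb l) (emb y) → OnSpan l y
  OnLine⇒OnSpan y∈l with OnLine-mapLine⁻ emb-linear y∈l
  ... | y′ , y′∈l , ey≡ey′ = subst (OnSpan _) (sym (emb-injective ey≡ey′)) y′∈l

  SameLine⇒SameSpan : ∀ {l m} → SameLine (mapLine emb l) (mapLine emb m) → SameSpan l m
  SameLine⇒SameSpan {u , v} {u′ , v′} l≈m =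
    (inside-m u (OnLine-first (emb u) (emb v)) , inside-m v (OnLine-second (emb u) (emb v))) ,
    (inside-l u′ (OnLine-first (emb u′) (emb v′)) , inside-l v′ (OnLine-second (emb u′) (emb v′)))
    where
    inside-m : ∀ y → OnLine (emb u , emb v) (emb y) → OnSpan (u′ , v′) y
    inside-m y y∈l = OnLine⇒OnSpan (proj₁ (l≈m (emb y)) y∈l)
    inside-l : ∀ y → OnLine (emb u′ , emb v′) (emb y) → OnSpan (u , v) y
    inside-l y y∈m = OnLine⇒OnSpan (proj₂ (l≈m (emb y)) y∈m)

  SameSpan⇒SameLine : ∀ {l m} → SameSpan l m → SameLine (mapLine emb l) (mapLine emb m)
  SameSpan⇒SameLine ((u∈m , v∈m) , (u′∈l , v′∈l)) x = transfer u∈m v∈m , transfer u′∈l v′∈l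
    where
    transfer : ∀ {l m} → OnSpan m (proj₁ l) → OnSpan m (proj₂ l) → OnLine (mapLine emb l) x → OnLine (mapLine emb m) x
    transfer u∈m v∈m x∈l with OnLine-mapLine⁻ emb-linear x∈l
    ... | y , y∈l , refl = OnLine-mapLine emb-linear (OnSpan-trans u∈m v∈m y∈l)

  solidLine : Fin 2 → Fin 4 → Line
  solidLine κ j = mapLine emb (modelLine κ j)

  solidLine-isLine : ∀ κ j → IsLineIn A H (solidLine κ j)
  solidLine-isLine κ j = independent , (λ a b → subst H (sym (emb-linear a u b v)) (emb-in-H _)) , singular
    where
    u v : Vec4
    u = proj₁ (modelLine κ j)
    v = proj₂ (modelLine κ j)
    independent : Indep2 (emb u) (emb v)
    independent a b vanishes =
      modelLine-independent κ j a b (emb-injective (trans (sym (emb-linear a u b v)) (trans vanishes (sym emb-0))))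
    singular : ∀ a b → quad A (a ⊙ emb u ⊕ b ⊙ emb v) ≡ 𝟘
    singular a b = begin
      quad A (a ⊙ emb u ⊕ b ⊙ emb v)             ≡⟨ cong (λ t → bil A t t) (emb-linear a u b v) ⟩
      quad A (emb (comb a u b v))                ≡⟨ emb-isometry (comb a u b v) (comb a u b v) ⟩
      c *₃ dot (comb a u b v) (comb a u b v)     ≡⟨ cong (c *₃_) (modelLine-isotropic κ j a b) ⟩
      c *₃ 𝟘                                     ≡⟨ *₃-zeroʳ c ⟩
      𝟘                                          ∎
      where open ≡-Reasoning

  classify-image : ∀ y y′ → IsLineIn A H (emb y , emb y′) → ∃₂ λ κ j → SameLine (emb y , emb y′) (solidLine κ j)
  classify-image y y′ (independent , _ , singular) = κ , j , SameSpan⇒SameLine same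
    where
    model-independent : Independent (y , y′)
    model-independent a b vanishes =
      independent a b (trans (emb-linear a y b y′) (trans (cong emb vanishes) emb-0))
    model-isotropic : Isotropic (y , y′)
    model-isotropic a b = *₃-cancelˡ-𝟘 c≢𝟘 (trans (sym (emb-isometry (comb a y b y′) (comb a y b y′)))
                            (trans (cong (λ t → bil A t t) (sym (emb-linear a y b y′))) (singular a b)))
    found : ∃₂ λ κ j → SameSpan (y , y′) (modelLine κ j)
    found = isotropic-line-is-modelLine y y′ model-independent model-isotropic
    κ : Fin 2
    κ = proj₁ found
    j : Fin 4
    j = proj₁ (proj₂ found)
    same : SameSpan (y , y′) (modelLine κ j)
    same = proj₂ (proj₂ found)

  classify : ∀ {l} → IsLineIn A H l → ∃₂ λ κ j → SameLine l (solidLine κ j)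
  classify {x , x′} line@(_ , in-H , _)
    with H-image x (subst H (comb-identityˡ x x′) (in-H 𝟙 𝟘)) | H-image x′ (subst H (comb-identityʳ x x′) (in-H 𝟘 𝟙))
  ... | y , refl | y′ , refl = classify-image y y′ line

  solidLine-injective : ∀ κ j κ′ j′ → SameLine (solidLine κ j) (solidLine κ′ j′) → κ ≡ κ′ × j ≡ j′
  solidLine-injective κ j κ′ j′ same = modelLine-injective κ j κ′ j′ (SameLine⇒SameSpan same)

  solidLines-meet : ∀ {κ κ′} j j′ → κ ≢ κ′ → ¬ DisjointLines (solidLine κ j) (solidLine κ′ j′)
  solidLines-meet {κ} {κ′} j j′ κ≢κ′ disjoint with modelLines-meet κ j κ′ j′ κ≢κ′
  ... | a , b , nonzero , p∈l′ = nonzero (modelLine-independent κ j a b (emb-injective (trans emb-p≡𝟎 (sym emb-0))))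
    where
    p : Vec4
    p = comb a (proj₁ (modelLine κ j)) b (proj₂ (modelLine κ j))
    emb-p≡𝟎 : emb p ≡ 𝟎
    emb-p≡𝟎 = disjoint (emb p) (OnLine-mapLine emb-linear (a , b , refl)) (OnLine-mapLine emb-linear p∈l′)

  solidLines-skew : ∀ κ {j j′} → j ≢ j′ → DisjointLines (solidLine κ j) (solidLine κ j′)
  solidLines-skew κ {j} {j′} j≢j′ x x∈l x∈l′ with OnLine-mapLine⁻ emb-linear x∈l
  ... | y , y∈l , refl = trans (cong emb (modelLines-skew κ j j′ j≢j′ y y∈l (OnLine⇒OnSpan x∈l′))) emb-0

  solidLines-compatible : ∀ κ {j j′} → j ≢ j′ → Compatible A (solidLine κ j) (solidLine κ j′)
  solidLines-compatible κ {j} {j′} j≢j′ =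
    perpFree-transport A c≢𝟘 emb emb-linear dot emb-isometry (modelLines-perpFree κ j j′ j≢j′) ,
    perpFree-transport A c≢𝟘 emb emb-linear dot emb-isometry (modelLines-perpFree κ j′ j (λ j′≡j → j≢j′ (sym j′≡j)))

  module Regulus {R : List Line} (regulus : IsRegulus A H R) where

    private
      l₀ : Line
      l₀ = proj₁ (proj₁ regulus)
      lines : ∀ l → l ∈ R → IsLineIn A H l
      lines = proj₁ (proj₂ regulus)
      distinct : DistinctLines R
      distinct = proj₁ (proj₂ (proj₂ regulus))
      skew-or-equal : ∀ m → IsLineIn A H m → (∃ λ k → SameLine (lookupL R k) m) → SameLine l₀ m ⊎ DisjointLines l₀ m
      skew-or-equal m m-line = proj₁ (proj₂ (proj₂ (proj₂ regulus)) l₀ (proj₂ (proj₁ regulus)) m m-line)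
      member : ∀ m → IsLineIn A H m → SameLine l₀ m ⊎ DisjointLines l₀ m → ∃ λ k → SameLine (lookupL R k) m
      member m m-line = proj₂ (proj₂ (proj₂ (proj₂ regulus)) l₀ (proj₂ (proj₁ regulus)) m m-line)
      start : ∃₂ λ κ j → SameLine l₀ (solidLine κ j)
      start = classify (lines l₀ (proj₂ (proj₁ regulus)))

    family : Fin 2
    family = proj₁ start

    private
      j₀ : Fin 4
      j₀ = proj₁ (proj₂ start)
      l₀≈ : SameLine l₀ (solidLine family j₀)
      l₀≈ = proj₂ (proj₂ start)

    -- A line of the regulus is skew to or equal to l₀, and lines of the other
    -- family meet l₀ in a point without being equal to it.
    family-lines : ∀ l → l ∈ R → ∃ λ j → SameLine l (solidLine family j)
    family-lines l l∈R with classify (lines l l∈R)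
    ... | κ , j , l≈ with family Finₚ.≟ κ
    ...   | yes refl = j , l≈
    ...   | no κ₀≢κ with skew-or-equal l (lines l l∈R) (index l∈R , subst (λ t → SameLine t l) (lookup-index l∈R) (SameLine-refl l))
    ...     | inj₁ l₀≈l = ⊥-elim (κ₀≢κ (proj₁ (solidLine-injective family j₀ κ j (SameLine-trans (SameLine-sym l₀≈) (SameLine-trans l₀≈l l≈)))))
    ...     | inj₂ l₀∩l = ⊥-elim (solidLines-meet j₀ j κ₀≢κ (DisjointLines-resp l₀≈ l≈ l₀∩l))

    size : length R ≡ 4
    size = Finₚ.cantor-schröder-bernstein {f = position} {g = λ j → proj₁ (occurrence j)} position-injective index-injective
      where
      position : Fin (length R) → Fin 4
      position k = proj₁ (family-lines (lookupL R k) (∈-lookup k))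
      position-injective : ∀ {k k′} → position k ≡ position k′ → k ≡ k′
      position-injective {k} {k′} same with k Finₚ.≟ k′
      ... | yes k≡k′ = k≡k′
      ... | no k≢k′ = ⊥-elim (distinct k k′ k≢k′ (SameLine-trans (proj₂ (family-lines _ (∈-lookup k)))
              (subst (λ j → SameLine (solidLine family j) (lookupL R k′)) (sym same) (SameLine-sym (proj₂ (family-lines _ (∈-lookup k′)))))))
      relation-to-l₀ : ∀ j → SameLine l₀ (solidLine family j) ⊎ DisjointLines l₀ (solidLine family j)
      relation-to-l₀ j with j₀ Finₚ.≟ j
      ... | yes refl = inj₁ l₀≈
      ... | no j₀≢j = inj₂ (DisjointLines-resp (SameLine-sym l₀≈) (SameLine-refl _) (solidLines-skew family j₀≢j))
      occurrence : ∀ j → ∃ λ k → SameLine (lookupL R k) (solidLine family j)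
      occurrence j = member _ (solidLine-isLine family j) (relation-to-l₀ j)
      index-injective : ∀ {j j′} → proj₁ (occurrence j) ≡ proj₁ (occurrence j′) → j ≡ j′
      index-injective {j} {j′} same = proj₂ (solidLine-injective family j family j′ (SameLine-trans (SameLine-sym (proj₂ (occurrence j)))
        (subst (λ k → SameLine (lookupL R k) (solidLine family j′)) (sym same) (proj₂ (occurrence j′)))))

    compatible : AllPairs (Compatible A) R
    compatible = AllPairs-from-lookup pair
      where
      pair : ∀ k k′ → k ≢ k′ → Compatible A (lookupL R k) (lookupL R k′)
      pair k k′ k≢k′ with family-lines _ (∈-lookup k) | family-lines _ (∈-lookup k′)
      ... | j , k≈ | j′ , k′≈ with j Finₚ.≟ j′
      ...   | yes refl = ⊥-elim (distinct k k′ k≢k′ (SameLine-trans k≈ (SameLine-sym k′≈)))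
      ...   | no j≢j′ = let (free , free′) = solidLines-compatible family j≢j′ in
                        DisjointFromPerp-resp {A} (SameLine-sym k≈) (SameLine-sym k′≈) free ,
                        DisjointFromPerp-resp {A} (SameLine-sym k′≈) (SameLine-sym k≈) free′

CrossCompatible : Vec (Fin 7) 4 → Vec (Fin 7) 4 → Set
CrossCompatible X Y = ∀ κ j κ′ j′ → PerpFree (λ w v → unitForm Y w X v) (modelLine κ j) (modelLine κ′ j′)
                                   × PerpFree (λ w v → unitForm X w Y v) (modelLine κ′ j′) (modelLine κ j)

crossCompatible? : ∀ X Y → Dec (CrossCompatible X Y)
crossCompatible? X Y = Finₚ.all? λ κ → Finₚ.all? λ j → Finₚ.all? λ κ′ → Finₚ.all? λ j′ →
  perpFree? (λ w v → unitForm Y w X v) (modelLine κ j) (modelLine κ′ j′) ×-dec perpFree? (λ w v → unitForm X w Y v) (modelLine κ′ j′) (modelLine κ j)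

unique? : ∀ {n} (X : Vec (Fin 7) n) → Dec (Unique X)
unique? = AllPairsᵛ.allPairs? λ i j → ¬? (i Finₚ.≟ j)

rPoints ℓPoints ℓ'Points : Fin 3 → Fin 7 × Fin 7
rPoints 0F = 0F , 1F
rPoints 1F = 1F , 2F
rPoints 2F = 2F , 0F
ℓPoints 0F = 3F , 4F
ℓPoints 1F = 3F , 6F
ℓPoints 2F = 3F , 5F
ℓ'Points 0F = 5F , 6F
ℓ'Points 1F = 4F , 5F
ℓ'Points 2F = 4F , 6F

solidSupport : Fin 7 × Fin 7 → Fin 7 × Fin 7 → Vec (Fin 7) 4
solidSupport (a , b) (c , d) = a ∷ b ∷ c ∷ d ∷ []

πSupport : Vec (Fin 7) 4
πSupport = 3F ∷ 4F ∷ 5F ∷ 6F ∷ []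

supports : Fin 3 → Fin 3 → Fin 3 → List (Vec (Fin 7) 4)
supports k₀ k₁ k₂ =
  solidSupport (rPoints 0F) (ℓPoints k₀) ∷ solidSupport (rPoints 0F) (ℓ'Points k₀) ∷
  solidSupport (rPoints 1F) (ℓPoints k₁) ∷ solidSupport (rPoints 1F) (ℓ'Points k₁) ∷
  solidSupport (rPoints 2F) (ℓPoints k₂) ∷ solidSupport (rPoints 2F) (ℓ'Points k₂) ∷ πSupport ∷ []

abstract
  solidSupports-unique : ∀ i k → Unique (solidSupport (rPoints i) (ℓPoints k)) × Unique (solidSupport (rPoints i) (ℓ'Points k))
  solidSupports-unique = toWitness {a? = Finₚ.all? λ i → Finₚ.all? λ k →
    unique? (solidSupport (rPoints i) (ℓPoints k)) ×-dec unique? (solidSupport (rPoints i) (ℓ'Points k))} _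

  πSupport-unique : Unique πSupport
  πSupport-unique = toWitness {a? = unique? πSupport} _

  -- Both reguli of every solid are checked: the statement leaves the choice open.
  supports-compatible : ∀ k₀ k₁ k₂ → k₀ ≢ k₁ → k₀ ≢ k₂ → k₁ ≢ k₂ → AllPairs CrossCompatible (supports k₀ k₁ k₂)
  supports-compatible = toWitness {a? = Finₚ.all? λ k₀ → Finₚ.all? λ k₁ → Finₚ.all? λ k₂ →
    ¬? (k₀ Finₚ.≟ k₁) →-dec (¬? (k₀ Finₚ.≟ k₂) →-dec (¬? (k₁ Finₚ.≟ k₂) →-dec
      AllPairs.allPairs? crossCompatible? (supports k₀ k₁ k₂)))} _

module Configuration (A : Mat) (sym-A : Symmetric A) (P : Fin 7 → Vec7) (self-polar : SelfPolarSimplex A P)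
                     {c : F3} (c≢𝟘 : c ≢ 𝟘) (quad≡c : ∀ k → quad A (P k) ≡ c) where
  open Simplex A sym-A P self-polar
  open Weights (λ _ → c) quad≡c

  bil-span-uniform : ∀ {m n} (X : Vec (Fin 7) m) y (Y : Vec (Fin 7) n) z → bil A (span X y) (span Y z) ≡ c *₃ unitForm X y Y z
  bil-span-uniform X y Y z = trans (bil-span X y Y z) (diagForm-scale c X y Y z)

  span-isometry : ∀ {n} (X : Vec (Fin 7) n) → Unique X → ∀ y z → bil A (span X y) (span X z) ≡ c *₃ dot y z
  span-isometry X X-unique y z = trans (bil-span-uniform X y X z) (cong (c *₃_) (unitForm-unique X y z X-unique))

  record Block : Set where
    field
      support : Vec (Fin 7) 4
      lines : List Line
      family : Fin 2
      family-lines : ∀ l → l ∈ lines → ∃ λ j → SameLine l (mapLine (span support) (modelLine family j))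
      size : length lines ≡ 4
      lines-singular : All (IsLineIn A whole) lines
      compatible : AllPairs (Compatible A) lines

  open Block

  regulusBlock : ∀ X → Unique X → ∀ H → (∀ x → H x → ∃ λ y → x ≡ span X y) → (∀ y → H (span X y)) →
                 ∀ {R} → IsRegulus A H R → Block
  regulusBlock X X-unique H H-image span-in-H {R} regulus = record
    { support = X
    ; lines = R
    ; family = Facts.family
    ; family-lines = Facts.family-lines
    ; size = Facts.size
    ; lines-singular = All.tabulate λ {l} l∈R → in-whole (proj₁ (proj₂ regulus) l l∈R)
    ; compatible = Facts.compatible }
    where
    module Facts = Solid.Regulus A sym-A c≢𝟘 H (span X) (span-comb X) (span-isometry X X-unique) H-image span-in-H regulus
    in-whole : ∀ {l} → IsLineIn A H l → IsLineIn A whole l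
    in-whole (independent , _ , singular) = independent , (λ _ _ → _) , singular

  blocks-compatible : ∀ b b′ → CrossCompatible (support b) (support b′) → All (λ l → All (Compatible A l) (lines b′)) (lines b)
  blocks-compatible b b′ cross = All.tabulate λ {l} l∈b → All.tabulate λ {m} m∈b′ → pair (family-lines b l l∈b) (family-lines b′ m m∈b′)
    where
    X Y : Vec (Fin 7) 4
    X = support b
    Y = support b′
    pair : ∀ {l m} → ∃ (λ j → SameLine l (mapLine (span X) (modelLine (family b) j))) →
                     ∃ (λ j′ → SameLine m (mapLine (span Y) (modelLine (family b′) j′))) → Compatible A l m
    pair (j , l≈) (j′ , m≈) = let (free , free′) = cross (family b) j (family b′) j′ in
      DisjointFromPerp-resp {A} (SameLine-sym l≈) (SameLine-sym m≈)
        (perpFree-transport A c≢𝟘 (span X) (span-comb Y) (λ w v → unitForm Y w X v) (λ w v → bil-span-uniform Y w X v) free) ,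
      DisjointFromPerp-resp {A} (SameLine-sym m≈) (SameLine-sym l≈)
        (perpFree-transport A c≢𝟘 (span Y) (span-comb X) (λ w v → unitForm X w Y v) (λ w v → bil-span-uniform X w Y v) free′)

  length-blocks : ∀ bs → length (concat (map lines bs)) ≡ length bs * 4
  length-blocks [] = refl
  length-blocks (b ∷ bs) = trans (length-++ (lines b)) (cong₂ _+_ (size b) (length-blocks bs))

  oneSystem-of-blocks : ∀ bs → length bs ≡ 7 → AllPairs CrossCompatible (map support bs) → OneSystem A (concat (map lines bs))
  oneSystem-of-blocks bs seven cross =
    oneSystem-of-compatible (trans (length-blocks bs) (cong (_* 4) seven)) singular compatible-lines
    where
    open Singular A sym-A
    singular : All (IsLineIn A whole) (concat (map lines bs))
    singular = Allₚ.concat⁺ (Allₚ.map⁺ {xs = bs} (All.tabulate λ {b} _ → lines-singular b))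
    compatible-lines : AllPairs (Compatible A) (concat (map lines bs))
    compatible-lines = AllPairsₚ.concat⁺ {xss = map lines bs} (Allₚ.map⁺ {xs = bs} (All.tabulate λ {b} _ → compatible b))
      (AllPairsₚ.map⁺ (AllPairs.map (λ {b} {b′} → blocks-compatible b b′) (AllPairsₚ.map⁻ cross)))

  pointLine : Fin 7 × Fin 7 → Line
  pointLine (a , b) = P a , P b

  rLine-points : ∀ i → rLine P i ≡ pointLine (rPoints i)
  rLine-points 0F = refl
  rLine-points 1F = refl
  rLine-points 2F = refl

  ℓLine-points : ∀ k → ℓLine P k ≡ pointLine (ℓPoints k)
  ℓLine-points 0F = refl
  ℓLine-points 1F = refl
  ℓLine-points 2F = refl

  ℓ'Line-points : ∀ k → ℓ'Line P k ≡ pointLine (ℓ'Points k)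
  ℓ'Line-points 0F = refl
  ℓ'Line-points 1F = refl
  ℓ'Line-points 2F = refl

  span4-as-span : ∀ a b c′ d s t u w → s ⊙ P a ⊕ t ⊙ P b ⊕ u ⊙ P c′ ⊕ w ⊙ P d ≡ span (a ∷ b ∷ c′ ∷ d ∷ []) (s ∷ t ∷ u ∷ w ∷ [])
  span4-as-span a b c′ d s t u w = begin
    s ⊙ P a ⊕ t ⊙ P b ⊕ u ⊙ P c′ ⊕ w ⊙ P d          ≡⟨ +ᵛ-assoc (s ⊙ P a ⊕ t ⊙ P b) (u ⊙ P c′) (w ⊙ P d) ⟩
    s ⊙ P a ⊕ t ⊙ P b ⊕ (u ⊙ P c′ ⊕ w ⊙ P d)        ≡⟨ +ᵛ-assoc (s ⊙ P a) (t ⊙ P b) (u ⊙ P c′ ⊕ w ⊙ P d) ⟩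
    s ⊙ P a ⊕ (t ⊙ P b ⊕ (u ⊙ P c′ ⊕ w ⊙ P d))      ≡⟨ cong (λ v → s ⊙ P a ⊕ (t ⊙ P b ⊕ (u ⊙ P c′ ⊕ v))) (sym (+ᵛ-identityʳ (w ⊙ P d))) ⟩
    span (a ∷ b ∷ c′ ∷ d ∷ []) (s ∷ t ∷ u ∷ w ∷ []) ∎
    where open ≡-Reasoning

  joinBlock : ∀ p q → Unique (solidSupport p q) → ∀ {R} → IsRegulus A (join (pointLine p) (pointLine q)) R → Block
  joinBlock (a , b) (c′ , d) X-unique = regulusBlock (a ∷ b ∷ c′ ∷ d ∷ []) X-unique _ image contains
    where
    image : ∀ x → span4 (P a) (P b) (P c′) (P d) x → ∃ λ y → x ≡ span (a ∷ b ∷ c′ ∷ d ∷ []) y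
    image x (s , t , u , w , refl) = (s ∷ t ∷ u ∷ w ∷ []) , span4-as-span a b c′ d s t u w
    contains : ∀ y → span4 (P a) (P b) (P c′) (P d) (span (a ∷ b ∷ c′ ∷ d ∷ []) y)
    contains (s ∷ t ∷ u ∷ w ∷ []) = s , t , u , w , sym (span4-as-span a b c′ d s t u w)

  bil-P-allIdx : ∀ k y → bil A (P k) (span allIdx y) ≡ c *₃ lookup y k
  bil-P-allIdx k y = begin
    bil A (P k) (span allIdx y)                        ≡⟨ cong (λ t → bil A t (span allIdx y)) (sym (span-single k)) ⟩
    bil A (span (k ∷ []) (𝟙 ∷ [])) (span allIdx y)     ≡⟨ bil-span-uniform (k ∷ []) (𝟙 ∷ []) allIdx y ⟩
    c *₃ unitForm (k ∷ []) (𝟙 ∷ []) allIdx y           ≡⟨ cong (c *₃_) (coordinate k y) ⟩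
    c *₃ lookup y k                                    ∎
    where
    open ≡-Reasoning
    coordinate : ∀ k y → unitForm (k ∷ []) (𝟙 ∷ []) allIdx y ≡ lookup y k
    coordinate 0F (y₀ ∷ y₁ ∷ y₂ ∷ y₃ ∷ y₄ ∷ y₅ ∷ y₆ ∷ []) = trans (+₃-identityʳ _) (+₃-identityʳ y₀)
    coordinate 1F (y₀ ∷ y₁ ∷ y₂ ∷ y₃ ∷ y₄ ∷ y₅ ∷ y₆ ∷ []) = trans (+₃-identityʳ _) (+₃-identityʳ y₁)
    coordinate 2F (y₀ ∷ y₁ ∷ y₂ ∷ y₃ ∷ y₄ ∷ y₅ ∷ y₆ ∷ []) = trans (+₃-identityʳ _) (+₃-identityʳ y₂)
    coordinate 3F (y₀ ∷ y₁ ∷ y₂ ∷ y₃ ∷ y₄ ∷ y₅ ∷ y₆ ∷ []) = trans (+₃-identityʳ _) (+₃-identityʳ y₃)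
    coordinate 4F (y₀ ∷ y₁ ∷ y₂ ∷ y₃ ∷ y₄ ∷ y₅ ∷ y₆ ∷ []) = trans (+₃-identityʳ _) (+₃-identityʳ y₄)
    coordinate 5F (y₀ ∷ y₁ ∷ y₂ ∷ y₃ ∷ y₄ ∷ y₅ ∷ y₆ ∷ []) = trans (+₃-identityʳ _) (+₃-identityʳ y₅)
    coordinate 6F (y₀ ∷ y₁ ∷ y₂ ∷ y₃ ∷ y₄ ∷ y₅ ∷ y₆ ∷ []) = trans (+₃-identityʳ _) (+₃-identityʳ y₆)

  πperp-image : ∀ x → πperp A P x → ∃ λ y → x ≡ span πSupport y
  πperp-image x (x⊥P₀ , x⊥P₁ , x⊥P₂) with proj₁ (self-polar 0F x) x⊥P₀
  ... | a , a₀≡𝟘 , refl = (a 3F ∷ a 4F ∷ a 5F ∷ a 6F ∷ []) , drop-prefix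
    where
    open ≡-Reasoning
    rest : Vec7
    rest = span πSupport (a 3F ∷ a 4F ∷ a 5F ∷ a 6F ∷ [])
    drop : ∀ p s → 𝟘 ⊙ p ⊕ s ≡ s
    drop p s = trans (cong (_⊕ s) (∙ᵛ-zeroˡ p)) (+ᵛ-identityˡ s)
    coefficient-zero : ∀ k → bil A (P k) (lincomb a P) ≡ 𝟘 → a k ≡ 𝟘
    coefficient-zero k x⊥Pₖ = *₃-cancelˡ-𝟘 c≢𝟘
      (trans (cong (c *₃_) (sym (lookup∘tabulate a k))) (trans (sym (bil-P-allIdx k (tabulate a))) x⊥Pₖ))
    drop-prefix : lincomb a P ≡ rest
    drop-prefix = begin
      a 0F ⊙ P 0F ⊕ (a 1F ⊙ P 1F ⊕ (a 2F ⊙ P 2F ⊕ rest)) ≡⟨ cong₂ (λ s t → s ⊙ P 0F ⊕ (t ⊙ P 1F ⊕ (a 2F ⊙ P 2F ⊕ rest))) a₀≡𝟘 (coefficient-zero 1F x⊥P₁) ⟩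
      𝟘 ⊙ P 0F ⊕ (𝟘 ⊙ P 1F ⊕ (a 2F ⊙ P 2F ⊕ rest))       ≡⟨ cong (λ t → 𝟘 ⊙ P 0F ⊕ (𝟘 ⊙ P 1F ⊕ (t ⊙ P 2F ⊕ rest))) (coefficient-zero 2F x⊥P₂) ⟩
      𝟘 ⊙ P 0F ⊕ (𝟘 ⊙ P 1F ⊕ (𝟘 ⊙ P 2F ⊕ rest))          ≡⟨ trans (drop (P 0F) _) (trans (drop (P 1F) _) (drop (P 2F) rest)) ⟩
      rest                                               ∎

  πperp-contains : ∀ y → πperp A P (span πSupport y)
  πperp-contains y@(_ ∷ _ ∷ _ ∷ _ ∷ []) = orthogonal-to 0F refl , orthogonal-to 1F refl , orthogonal-to 2F refl
    where
    orthogonal-to : ∀ k → unitForm (k ∷ []) (𝟙 ∷ []) πSupport y ≡ 𝟘 → perp A (P k) (span πSupport y)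
    orthogonal-to k form≡𝟘 = trans (cong (λ t → bil A t (span πSupport y)) (sym (span-single k)))
      (trans (bil-span-uniform (k ∷ []) (𝟙 ∷ []) πSupport y) (trans (cong (c *₃_) form≡𝟘) (*₃-zeroʳ c)))

  πBlock : ∀ {R} → IsRegulus A (πperp A P) R → Block
  πBlock = regulusBlock πSupport πSupport-unique (πperp A P) πperp-image πperp-contains

  rℓBlock : ∀ i k {R} → IsRegulus A (join (rLine P i) (ℓLine P k)) R → Block
  rℓBlock i k {R} regulus = joinBlock (rPoints i) (ℓPoints k) (proj₁ (solidSupports-unique i k))
    (subst₂ (λ l m → IsRegulus A (join l m) R) (rLine-points i) (ℓLine-points k) regulus)

  rℓ'Block : ∀ i k {R} → IsRegulus A (join (rLine P i) (ℓ'Line P k)) R → Block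
  rℓ'Block i k {R} regulus = joinBlock (rPoints i) (ℓ'Points k) (proj₂ (solidSupports-unique i k))
    (subst₂ (λ l m → IsRegulus A (join l m) R) (rLine-points i) (ℓ'Line-points k) regulus)

  union-isOneSystem : (k : Fin 3 → Fin 3) → (∀ {i j} → k i ≡ k j → i ≡ j) → (R R′ : Fin 3 → List Line) (R₀ : List Line) →
            (∀ i → IsRegulus A (join (rLine P i) (ℓLine P (k i))) (R i)) →
            (∀ i → IsRegulus A (join (rLine P i) (ℓ'Line P (k i))) (R′ i)) →
            IsRegulus A (πperp A P) R₀ → OneSystem A (unionS R R′ R₀)
  union-isOneSystem k k-injective R R′ R₀ HR HR′ HR₀ =
    subst (OneSystem A) concat≡union (oneSystem-of-blocks blocks refl (supports-compatible _ _ _ (ne 0F 1F λ ()) (ne 0F 2F λ ()) (ne 1F 2F λ ())))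
    where
    blocks : List Block
    blocks = rℓBlock 0F (k 0F) (HR 0F) ∷ rℓ'Block 0F (k 0F) (HR′ 0F) ∷ rℓBlock 1F (k 1F) (HR 1F) ∷ rℓ'Block 1F (k 1F) (HR′ 1F)
           ∷ rℓBlock 2F (k 2F) (HR 2F) ∷ rℓ'Block 2F (k 2F) (HR′ 2F) ∷ πBlock HR₀ ∷ []
    ne : ∀ i j → i ≢ j → k i ≢ k j
    ne i j i≢j ki≡kj = i≢j (k-injective ki≡kj)
    concat≡union : concat (map lines blocks) ≡ unionS R R′ R₀
    concat≡union = cong (λ t → R 0F ++ R′ 0F ++ R 1F ++ R′ 1F ++ R 2F ++ R′ 2F ++ t) (++-identityʳ R₀)

mainTheorem9 : (A : Mat) → Symmetric A → Nondegenerate A →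
    (P : Fin 7 → Vec7) → (∀ i → Internal A (P i)) → SelfPolarSimplex A P →
    (φ : Permutation′ 3) →
    (R R' : Fin 3 → List Line) → (R₀ : List Line) →
    (∀ i → IsRegulus A (join (rLine P i) (ℓLine P (φ ⟨$⟩ʳ i))) (R i)) →
    (∀ i → IsRegulus A (join (rLine P i) (ℓ'Line P (φ ⟨$⟩ʳ i))) (R' i)) →
    IsRegulus A (πperp A P) R₀ →
    OneSystem A (unionS R R' R₀)
mainTheorem9 A sym-A _ P internal self-polar φ R R′ R₀ HR HR′ HR₀
  with Simplex.uniform-weights A sym-A P self-polar internal
... | c , c≢𝟘 , quad≡c =
  Configuration.union-isOneSystem A sym-A P self-polar c≢𝟘 quad≡c (φ ⟨$⟩ʳ_) φ-injective R R′ R₀ HR HR′ HR₀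
  where
  φ-injective : ∀ {i j} → φ ⟨$⟩ʳ i ≡ φ ⟨$⟩ʳ j → i ≡ j
  φ-injective {i} {j} same = trans (sym (inverseˡ φ)) (trans (cong (φ ⟨$⟩ˡ_) same) (inverseˡ φ))
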